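{- Let $\Gamma$ be a distance-regular graph with diameter $D\ge3$ and $a_1\ne0$. Let $\sigma_0,\dots,\sigma_D$ be a nontrivial pseudo cosine sequence that is tight, with auxiliary parameter $\varepsilon$, and write $\sigma=\sigma_1$. Then the numbers $(\sigma_{i+1}-\sigma_i)(\sigma_{i-1}-\sigma_i)$ $(1\le i\le D-1)$ and $(\sigma^2-\sigma_2)(1-\varepsilon\sigma)$ are nonzero, and $$a_i=g\,\frac{(\sigma_{i+1}-\sigma\sigma_i)(\sigma_{i-1}-\sigma\sigma_i)}{(\sigma_{i+1}-\sigma_i)(\sigma_{i-1}-\sigma_i)}\quad(1\le i\le D-1),\qquad\text{where}\qquad g=\frac{(\varepsilon-1)(1-\sigma_2)}{(\sigma^2-\sigma_2)(1-\varepsilon\sigma)}.$$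
   Context: $\Gamma$ is a finite, undirected, connected graph without loops or multiple edges, with path-length distance $\partial$ and diameter $D$. It is distance-regular: for all $0\le h,i,j\le D$ and all vertices $x,y$ with $\partial(x,y)=h$, the number $p^h_{ij}$ of vertices $z$ with $\partial(x,z)=i$, $\partial(y,z)=j$ depends only on $h,i,j$. Write $a_i=p^i_{1i}$, $b_i=p^i_{1,i+1}$ $(0\le i\le D-1)$, $c_i=p^i_{1,i-1}$ $(1\le i\le D)$, $c_0=0$, $b_D=0$, $k=b_0$. A pseudo cosine sequence (for $\theta\in\mathbb{R}$) is a sequence of reals $\sigma_0,\dots,\sigma_D$ with $\sigma_0=1$ and $c_i\sigma_{i-1}+a_i\sigma_i+b_i\sigma_{i+1}=\theta\sigma_i$ for $0\le i\le D-1$ (with $c_0\sigma_{ -1}=0$). It is trivial if it is the one for $\theta=k$ (all entries $1$), nontrivial otherwise. Two pseudo cosine sequences $\sigma_i,\rho_i$ form a tight pair if $\sigma_0\rho_0,\dots,\sigma_D\rho_D$ is a pseudo cosine sequence. A nontrivial pseudo cosine sequence $\sigma_0,\dots,\sigma_D$ is tight if there is a nontrivial pseudo cosine sequence $\rho_0,\dots,\rho_D$ forming a tight pair with it; $\varepsilon\in\mathbb{R}$ is its auxiliary parameter if for such $\rho$, $\sigma_i\rho_i-\sigma_{i-1}\rho_{i-1}=\varepsilon(\sigma_{i-1}\rho_i-\sigma_i\rho_{i-1})$ for $1\le i\le D$. -}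

module Defs where

open import Data.Nat as ℕ using (ℕ; zero; suc; _∸_)
open import Data.Fin using (Fin)
open import Data.Fin.Properties using (_≟_)
open import Data.Bool using (Bool; true; false; _∧_; _∨_; not)
open import Data.List using (List; length; filterᵇ; allFin)
open import Data.Bool.ListAction using (any)
open import Data.Product using (Σ; _×_; _,_; ∃)
open import Data.Sum using (_⊎_)
open import Relation.Nullary using (¬_)
open import Relation.Nullary.Decidable using (⌊_⌋)
open import Relation.Binary.PropositionalEquality using (_≡_; _≢_)

-- The real numbers, axiomatised as a (Dedekind-)complete ordered field.
-- Any two such structures are isomorphic, so quantifying over every
-- `RealField` is the same as speaking about ℝ.

record RealField : Set₁ where
  infixl 6 _+_ _-_
  infixl 7 _*_
  infix  4 _<_ _≤_
  field
    Carrier : Set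
    0# 1#   : Carrier
    _+_ _*_ : Carrier → Carrier → Carrier
    -_      : Carrier → Carrier
    _⁻¹     : Carrier → Carrier
    _<_     : Carrier → Carrier → Set
    +-assoc  : ∀ x y z → (x + y) + z ≡ x + (y + z)
    +-comm   : ∀ x y → x + y ≡ y + x
    +-idʳ    : ∀ x → x + 0# ≡ x
    +-invʳ   : ∀ x → x + (- x) ≡ 0#
    *-assoc  : ∀ x y z → (x * y) * z ≡ x * (y * z)
    *-comm   : ∀ x y → x * y ≡ y * x
    *-idʳ    : ∀ x → x * 1# ≡ x
    distribʳ : ∀ x y z → x * (y + z) ≡ x * y + x * z
    *-invʳ   : ∀ x → x ≢ 0# → x * (x ⁻¹) ≡ 1#
    0≢1      : 0# ≢ 1#
    <-irrefl : ∀ x → ¬ (x < x)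
    <-trans  : ∀ x y z → x < y → y < z → x < z
    <-tri    : ∀ x y → x < y ⊎ (x ≡ y ⊎ y < x)
    <-+      : ∀ x y z → x < y → x + z < y + z
    <-*      : ∀ x y → 0# < x → 0# < y → 0# < x * y
    complete : (S : Carrier → Set) → (∃ λ x → S x) →
               (∃ λ u → ∀ x → S x → x < u ⊎ x ≡ u) →
               ∃ λ s → (∀ x → S x → x < s ⊎ x ≡ s) ×
                       (∀ u → (∀ x → S x → x < u ⊎ x ≡ u) → s < u ⊎ s ≡ u)

  _≤_ : Carrier → Carrier → Set
  x ≤ y = x < y ⊎ x ≡ y

  _-_ : Carrier → Carrier → Carrier
  x - y = x + (- y)

  fromℕ : ℕ → Carrier
  fromℕ zero    = 0#
  fromℕ (suc n) = 1# + fromℕ n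

record Graph (n : ℕ) : Set where
  field
    adj       : Fin n → Fin n → Bool
    adj-sym   : ∀ x y → adj x y ≡ adj y x
    adj-irref : ∀ x → adj x x ≡ false

module _ {n : ℕ} (Γ : Graph n) where
  open Graph Γ

  -- reach k x y = true  iff  ∂(x,y) ≤ k
  reach : ℕ → Fin n → Fin n → Bool
  reach zero    x y = ⌊ x ≟ y ⌋
  reach (suc k) x y = reach k x y ∨ any (λ z → reach k x z ∧ adj z y) (allFin n)

  isDist : Fin n → Fin n → ℕ → Bool
  isDist x y zero    = reach zero x y
  isDist x y (suc i) = reach (suc i) x y ∧ not (reach i x y)

  Connected : Set
  Connected = ∀ x y → ∃ λ d → isDist x y d ≡ true

  HasDiameter : ℕ → Set
  HasDiameter D = (∀ x y d → isDist x y d ≡ true → d ℕ.≤ D)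
                × (∃ λ x → ∃ λ y → isDist x y D ≡ true)

  count : Fin n → Fin n → ℕ → ℕ → ℕ
  count x y i j = length (filterᵇ (λ z → isDist x z i ∧ isDist y z j) (allFin n))

  IntersectionNumbers : ℕ → (ℕ → ℕ → ℕ → ℕ) → Set
  IntersectionNumbers D p = ∀ h i j → h ℕ.≤ D → i ℕ.≤ D → j ℕ.≤ D →
    ∀ x y → isDist x y h ≡ true → count x y i j ≡ p h i j

  DistanceRegular : ℕ → Set
  DistanceRegular D = Connected × HasDiameter D ×
                      ∃ λ p → IntersectionNumbers D p

module Params (D : ℕ) (p : ℕ → ℕ → ℕ → ℕ) where
  a : ℕ → ℕ
  a i = p i 1 i

  b : ℕ → ℕ
  b i = p i 1 (suc i)

  c : ℕ → ℕ
  c zero    = 0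
  c (suc i) = p (suc i) 1 i

  k : ℕ
  k = b 0

-- Pseudo cosine sequences (sequences indexed by ℕ; only σ_0..σ_D matter).

module Cosine (R : RealField) (D : ℕ) (p : ℕ → ℕ → ℕ → ℕ) where
  open RealField R
  open Params D p

  -- c_i σ_{i-1} (with c_0 σ_{-1} = 0)
  cσ : (ℕ → Carrier) → ℕ → Carrier
  cσ σ zero    = 0#
  cσ σ (suc i) = fromℕ (c (suc i)) * σ i

  IsPCS : (ℕ → Carrier) → Carrier → Set
  IsPCS σ θ = σ 0 ≡ 1# ×
    (∀ i → i ℕ.< D →
      cσ σ i + fromℕ (a i) * σ i + fromℕ (b i) * σ (suc i) ≡ θ * σ i)

  PCS : (ℕ → Carrier) → Set
  PCS σ = ∃ λ θ → IsPCS σ θ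

  NontrivialPCS : (ℕ → Carrier) → Set
  NontrivialPCS σ = PCS σ × ¬ IsPCS σ (fromℕ k)

  TightPair : (ℕ → Carrier) → (ℕ → Carrier) → Set
  TightPair σ ρ = PCS σ × PCS ρ × PCS (λ i → σ i * ρ i)

  Tight : (ℕ → Carrier) → Set
  Tight σ = NontrivialPCS σ × ∃ λ ρ → NontrivialPCS ρ × TightPair σ ρ

  AuxiliaryParameter : (ℕ → Carrier) → Carrier → Set
  AuxiliaryParameter σ ε = ∃ λ ρ → NontrivialPCS ρ × TightPair σ ρ ×
    (∀ i → 1 ℕ.≤ i → i ℕ.≤ D →
      σ i * ρ i - σ (i ∸ 1) * ρ (i ∸ 1)
        ≡ ε * (σ (i ∸ 1) * ρ i - σ i * ρ (i ∸ 1)))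

module Submission where

-- Let ρ be the sequence forming a tight pair with σ that witnesses ε, and
-- τ = σρ.  From i = 0 (a₀ = 0, b₀ = k) the three sequences obey the
-- recurrence cᵢ xᵢ₋₁ + aᵢ xᵢ + bᵢ xᵢ₊₁ = θ xᵢ with θ = kσ, kρ₁, kσρ₁, and
-- consecutive terms of σ and ρ are tied by the relation defining ε.  At a
-- fixed i these are polynomial equations in cᵢ, aᵢ, bᵢ: eliminating ρᵢ₋₁,
-- ρᵢ₊₁ and then cᵢ, bᵢ (via cᵢ + aᵢ + bᵢ = k) gives
--   aᵢ (σᵢ₋₁ − σᵢ)(σᵢ₊₁ − σᵢ)(σ − ε) = k (1 − ε)(σᵢ₊₁ − σσᵢ)(σᵢ₋₁ − σσᵢ),
-- the degenerate configurations being excluded one at a time.  At i = 1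
-- this determines k, and substituting k back gives the formula for aᵢ.
-- The needed non-degeneracy (ε ≠ ±1, σ ≠ ε, σᵢ ≠ σᵢ₊₁, the denominator
-- of g) rests on a₁ ≠ 0, on a₂ ≠ 0 (which follows from a₁ ≠ 0 and D ≥ 3)
-- and on a pseudo cosine sequence never having two consecutive zeros.

open import Defs
open import Data.Nat using (ℕ; suc; _∸_)
import Data.Nat as N
open import Data.Product using (_×_)
open import Relation.Binary.PropositionalEquality using (_≡_; _≢_)

open import Algebra.Bundles using (CommutativeRing; RawRing)
import Algebra.Solver.Ring
import Algebra.Solver.Ring.AlmostCommutativeRing as ACR
open import Data.Bool using (Bool; true; false; T; T?; _∧_; not)
open import Data.Bool.Properties using (T-∧; T-∨; T-≡)
open import Data.Empty using (⊥; ⊥-elim)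
open import Data.Fin using (Fin)
open import Data.Integer as ℤ using (ℤ; 0ℤ; 1ℤ; -1ℤ)
import Data.Integer.Properties as ℤ
open import Data.List using (List; []; _∷_; length; filterᵇ; allFin)
open import Data.List.Membership.Propositional using (_∈_; lose)
open import Data.List.Membership.Propositional.Properties using (∈-allFin; ∈-filter⁺; ∈-filter⁻)
open import Data.List.Properties using (filter-some; filter-none)
open import Data.List.Relation.Unary.All as All using (All)
open import Data.List.Relation.Unary.Any using (here; satisfied)
open import Data.List.Relation.Unary.Any.Properties using (any⁺; any⁻)
open import Data.List.Relation.Unary.Unique.Propositional using (Unique; []; _∷_)
import Data.List.Relation.Unary.Unique.Propositional.Properties as Unique
open import Data.Maybe using (Maybe; just; nothing)
open import Data.Nat using (zero; z≤n; s≤s; _≤′_; ≤′-refl; ≤′-step)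
import Data.Nat.Properties as ℕ
open import Data.Nat.Tactic.RingSolver using (solve-∀)
open import Data.Product using (∃-syntax; _,_; proj₁; proj₂; uncurry′)
open import Data.Sum using (_⊎_; inj₁; inj₂; [_,_]′)
open import Data.Vec as Vec using (Vec; []; _∷_)
open import Data.Vec.N-ary using (N-ary; _$ⁿ_)
open import Function using (_∘_; Equivalence)
open import Relation.Binary.PropositionalEquality
open import Relation.Nullary using (¬_; Dec; yes; no)
open import Relation.Nullary.Decidable using (toWitness; fromWitness)

module FieldProperties (R : RealField) where
  open RealField R
  open ≡-Reasoning

  +-identityˡ : ∀ x → 0# + x ≡ x
  +-identityˡ x = trans (+-comm 0# x) (+-idʳ x)

  +-inverseˡ : ∀ x → - x + x ≡ 0#
  +-inverseˡ x = trans (+-comm (- x) x) (+-invʳ x)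

  *-identityˡ : ∀ x → 1# * x ≡ x
  *-identityˡ x = trans (*-comm 1# x) (*-idʳ x)

  *-distribʳ-+ : ∀ x y z → (y + z) * x ≡ y * x + z * x
  *-distribʳ-+ x y z = begin
    (y + z) * x    ≡⟨ *-comm (y + z) x ⟩
    x * (y + z)    ≡⟨ distribʳ x y z ⟩
    x * y + x * z  ≡⟨ cong₂ _+_ (*-comm x y) (*-comm x z) ⟩
    y * x + z * x  ∎

  commutativeRing : CommutativeRing _ _
  commutativeRing = record
    { Carrier = Carrier ; _≈_ = _≡_ ; _+_ = _+_ ; _*_ = _*_ ; -_ = -_ ; 0# = 0# ; 1# = 1#
    ; isCommutativeRing = record
      { isRing = record
        { +-isAbelianGroup = record
          { isGroup = record
            { isMonoid = record
              { isSemigroup = record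
                { isMagma = record { isEquivalence = isEquivalence ; ∙-cong = cong₂ _+_ }
                ; assoc = +-assoc }
              ; identity = +-identityˡ , +-idʳ }
            ; inverse = +-inverseˡ , +-invʳ
            ; ⁻¹-cong = cong (λ x → - x) }
          ; comm = +-comm }
        ; *-cong = cong₂ _*_
        ; *-assoc = *-assoc
        ; *-identity = *-identityˡ , *-idʳ
        ; distrib = distribʳ , *-distribʳ-+ }
      ; *-comm = *-comm } }

  open CommutativeRing commutativeRing public
    using (ring; zeroˡ; zeroʳ)
  open import Algebra.Properties.Ring ring public
    using (-‿distribˡ-*; -‿distribʳ-*; -‿involutive; -0#≈0#; -‿+-comm; -1*x≈-x;
           x∙y⁻¹≈ε⇒x≈y; x[y-z]≈xy-xz)

  fromℕ-+ : ∀ m n → fromℕ (m N.+ n) ≡ fromℕ m + fromℕ n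
  fromℕ-+ zero    n = sym (+-identityˡ _)
  fromℕ-+ (suc m) n = trans (cong (1# +_) (fromℕ-+ m n)) (sym (+-assoc _ _ _))

  fromℕ-* : ∀ m n → fromℕ (m N.* n) ≡ fromℕ m * fromℕ n
  fromℕ-* zero    n = sym (zeroˡ _)
  fromℕ-* (suc m) n = begin
    fromℕ (n N.+ m N.* n)       ≡⟨ fromℕ-+ n (m N.* n) ⟩
    fromℕ n + fromℕ (m N.* n)   ≡⟨ cong₂ _+_ (sym (*-identityˡ _)) (fromℕ-* m n) ⟩
    1# * fromℕ n + fromℕ m * fromℕ n ≡⟨ sym (*-distribʳ-+ _ _ _) ⟩
    (1# + fromℕ m) * fromℕ n    ∎

  x-y≡0⇒x≡y : ∀ {x y} → x - y ≡ 0# → x ≡ y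
  x-y≡0⇒x≡y = x∙y⁻¹≈ε⇒x≈y _ _

  x≢y⇒x-y≢0 : ∀ {x y} → x ≢ y → x - y ≢ 0#
  x≢y⇒x-y≢0 x≢y = x≢y ∘ x-y≡0⇒x≡y

  <⇒≢ : ∀ {x y} → x < y → x ≢ y
  <⇒≢ {x} x<x refl = <-irrefl x x<x

  _≟_ : ∀ x y → Dec (x ≡ y)
  x ≟ y with <-tri x y
  ... | inj₁ x<y        = no (<⇒≢ x<y)
  ... | inj₂ (inj₁ x≡y) = yes x≡y
  ... | inj₂ (inj₂ y<x) = no (<⇒≢ y<x ∘ sym)

  x≢0⇒x*y≡0⇒y≡0 : ∀ {x y} → x ≢ 0# → x * y ≡ 0# → y ≡ 0#
  x≢0⇒x*y≡0⇒y≡0 {x} {y} x≢0 xy≡0 = begin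
    y                ≡⟨ sym (*-identityˡ y) ⟩
    1# * y           ≡⟨ cong (_* y) (sym (trans (*-comm _ _) (*-invʳ x x≢0))) ⟩
    (x ⁻¹ * x) * y   ≡⟨ *-assoc _ _ _ ⟩
    x ⁻¹ * (x * y)   ≡⟨ cong (x ⁻¹ *_) xy≡0 ⟩
    x ⁻¹ * 0#        ≡⟨ zeroʳ _ ⟩
    0#               ∎

  y≢0⇒x*y≡0⇒x≡0 : ∀ {x y} → y ≢ 0# → x * y ≡ 0# → x ≡ 0#
  y≢0⇒x*y≡0⇒x≡0 {x} {y} y≢0 xy≡0 = x≢0⇒x*y≡0⇒y≡0 y≢0 (trans (*-comm y x) xy≡0)

  x*y≡0⇒x≡0⊎y≡0 : ∀ {x y} → x * y ≡ 0# → x ≡ 0# ⊎ y ≡ 0#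
  x*y≡0⇒x≡0⊎y≡0 {x} xy≡0 with x ≟ 0#
  ... | yes x≡0 = inj₁ x≡0
  ... | no  x≢0 = inj₂ (x≢0⇒x*y≡0⇒y≡0 x≢0 xy≡0)

  x≢0∧y≢0⇒x*y≢0 : ∀ {x y} → x ≢ 0# → y ≢ 0# → x * y ≢ 0#
  x≢0∧y≢0⇒x*y≢0 x≢0 y≢0 xy≡0 = y≢0 (x≢0⇒x*y≡0⇒y≡0 x≢0 xy≡0)

  *-cancelˡ : ∀ {x y z} → x ≢ 0# → x * y ≡ x * z → y ≡ z
  *-cancelˡ {x} {y} {z} x≢0 xy≡xz = x-y≡0⇒x≡y (x≢0⇒x*y≡0⇒y≡0 x≢0 (begin
    x * (y - z)           ≡⟨ x[y-z]≈xy-xz x y z ⟩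
    x * y - x * z         ≡⟨ cong (_- x * z) xy≡xz ⟩
    x * z - x * z         ≡⟨ +-invʳ (x * z) ⟩
    0#                    ∎))

  *-cancelʳ : ∀ {x y z} → x ≢ 0# → y * x ≡ z * x → y ≡ z
  *-cancelʳ {x} {y} {z} x≢0 yx≡zx = *-cancelˡ x≢0 (trans (*-comm x y) (trans yx≡zx (*-comm z x)))

  0<1 : 0# < 1#
  0<1 with <-tri 0# 1#
  ... | inj₁ 0<1        = 0<1
  ... | inj₂ (inj₁ 0≡1) = ⊥-elim (0≢1 0≡1)
  ... | inj₂ (inj₂ 1<0) = ⊥-elim (<-irrefl 1# (<-trans 1# 0# 1# 1<0 0<[-1]*[-1]))
    where
    0<-1 : 0# < - 1#
    0<-1 = subst₂ _<_ (+-invʳ 1#) (+-identityˡ (- 1#)) (<-+ 1# 0# (- 1#) 1<0)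
    [-1]*[-1]≡1 : - 1# * - 1# ≡ 1#
    [-1]*[-1]≡1 = begin
      - 1# * - 1#     ≡⟨ -1*x≈-x (- 1#) ⟩
      - - 1#          ≡⟨ -‿involutive 1# ⟩
      1#              ∎
    0<[-1]*[-1] : 0# < 1#
    0<[-1]*[-1] = subst (0# <_) [-1]*[-1]≡1 (<-* (- 1#) (- 1#) 0<-1 0<-1)

  0<fromℕ-suc : ∀ n → 0# < fromℕ (suc n)
  0<fromℕ-suc zero    = subst (0# <_) (sym (+-idʳ 1#)) 0<1
  0<fromℕ-suc (suc n) = <-trans 0# 1# (fromℕ (suc (suc n))) 0<1
    (subst₂ _<_ (+-identityˡ 1#) (+-comm _ _) (<-+ 0# (fromℕ (suc n)) 1# (0<fromℕ-suc n)))

  fromℕ≡0⇒≡0 : ∀ {n} → fromℕ n ≡ 0# → n ≡ 0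
  fromℕ≡0⇒≡0 {zero}  _     = refl
  fromℕ≡0⇒≡0 {suc n} 1+n≡0 = ⊥-elim (<⇒≢ (0<fromℕ-suc n) (sym 1+n≡0))

  fromℕ-≢0 : ∀ {n} → n ≢ 0 → fromℕ n ≢ 0#
  fromℕ-≢0 n≢0 = n≢0 ∘ fromℕ≡0⇒≡0

module IntegerSolver (R : RealField) where
  open RealField R
  open FieldProperties R
  open ≡-Reasoning

  fromℤ : ℤ → Carrier
  fromℤ (ℤ.+ n)    = fromℕ n
  fromℤ ℤ.-[1+ n ] = - fromℕ (suc n)

  fromℤ-‿ : ∀ i → fromℤ (ℤ.- i) ≡ - fromℤ i
  fromℤ-‿ ℤ.-[1+ n ]  = sym (-‿involutive _)
  fromℤ-‿ (ℤ.+ zero)  = sym -0#≈0#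
  fromℤ-‿ (ℤ.+ suc n) = refl

  fromℤ-⊖ : ∀ m n → fromℤ (m ℤ.⊖ n) ≡ fromℕ m - fromℕ n
  fromℤ-⊖ zero    zero    = sym (+-invʳ 0#)
  fromℤ-⊖ (suc m) zero    = trans (sym (+-idʳ _)) (cong (fromℕ (suc m) +_) (sym -0#≈0#))
  fromℤ-⊖ zero    (suc n) = sym (+-identityˡ _)
  fromℤ-⊖ (suc m) (suc n) = begin
    fromℤ (suc m ℤ.⊖ suc n)               ≡⟨ cong fromℤ (ℤ.[1+m]⊖[1+n]≡m⊖n m n) ⟩
    fromℤ (m ℤ.⊖ n)                       ≡⟨ fromℤ-⊖ m n ⟩
    fromℕ m - fromℕ n                     ≡⟨ sym (+-identityˡ _) ⟩
    0# + (fromℕ m - fromℕ n)              ≡⟨ cong (_+ (fromℕ m - fromℕ n)) (sym (+-invʳ 1#)) ⟩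
    (1# - 1#) + (fromℕ m - fromℕ n)       ≡⟨ +-assoc 1# (- 1#) _ ⟩
    1# + (- 1# + (fromℕ m - fromℕ n))     ≡⟨ cong (1# +_) (sym (+-assoc (- 1#) _ _)) ⟩
    1# + ((- 1# + fromℕ m) - fromℕ n)     ≡⟨ cong (λ x → 1# + (x - fromℕ n)) (+-comm (- 1#) _) ⟩
    1# + ((fromℕ m - 1#) - fromℕ n)       ≡⟨ cong (1# +_) (+-assoc (fromℕ m) _ _) ⟩
    1# + (fromℕ m + (- 1# - fromℕ n))     ≡⟨ sym (+-assoc 1# _ _) ⟩
    (1# + fromℕ m) + (- 1# - fromℕ n)     ≡⟨ cong ((1# + fromℕ m) +_) (-‿+-comm 1# (fromℕ n)) ⟩
    (1# + fromℕ m) - (1# + fromℕ n)       ∎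

  fromℤ-+ : ∀ i j → fromℤ (i ℤ.+ j) ≡ fromℤ i + fromℤ j
  fromℤ-+ (ℤ.+ m)    (ℤ.+ n)    = fromℕ-+ m n
  fromℤ-+ (ℤ.+ m)    ℤ.-[1+ n ] = fromℤ-⊖ m (suc n)
  fromℤ-+ ℤ.-[1+ m ] (ℤ.+ n)    = trans (fromℤ-⊖ n (suc m)) (+-comm _ _)
  fromℤ-+ ℤ.-[1+ m ] ℤ.-[1+ n ] = begin
    - fromℕ (suc (suc (m N.+ n)))         ≡⟨ cong (λ k → - fromℕ (suc k)) (sym (ℕ.+-suc m n)) ⟩
    - (1# + fromℕ (m N.+ suc n))          ≡⟨ cong (λ x → - (1# + x)) (fromℕ-+ m (suc n)) ⟩
    - (1# + (fromℕ m + fromℕ (suc n)))    ≡⟨ cong (λ x → - x) (sym (+-assoc 1# _ _)) ⟩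
    - (fromℕ (suc m) + fromℕ (suc n))     ≡⟨ sym (-‿+-comm _ _) ⟩
    - fromℕ (suc m) - fromℕ (suc n)       ∎

  fromℤ-+* : ∀ m j → fromℤ (ℤ.+ m ℤ.* j) ≡ fromℕ m * fromℤ j
  fromℤ-+* m (ℤ.+ n)    = trans (cong fromℤ (sym (ℤ.pos-* m n))) (fromℕ-* m n)
  fromℤ-+* m ℤ.-[1+ n ] = begin
    fromℤ (ℤ.+ m ℤ.* ℤ.-[1+ n ])
        ≡⟨ cong fromℤ (sym (ℤ.neg-distribʳ-* (ℤ.+ m) (ℤ.+ suc n))) ⟩
    fromℤ (ℤ.- (ℤ.+ m ℤ.* ℤ.+ suc n))     ≡⟨ fromℤ-‿ (ℤ.+ m ℤ.* ℤ.+ suc n) ⟩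
    - fromℤ (ℤ.+ m ℤ.* ℤ.+ suc n)         ≡⟨ cong (λ x → - x) (fromℤ-+* m (ℤ.+ suc n)) ⟩
    - (fromℕ m * fromℕ (suc n))           ≡⟨ -‿distribʳ-* _ _ ⟩
    fromℕ m * - fromℕ (suc n)             ∎

  fromℤ-* : ∀ i j → fromℤ (i ℤ.* j) ≡ fromℤ i * fromℤ j
  fromℤ-* (ℤ.+ m)    j = fromℤ-+* m j
  fromℤ-* ℤ.-[1+ m ] j = begin
    fromℤ (ℤ.-[1+ m ] ℤ.* j)              ≡⟨ cong fromℤ (sym (ℤ.neg-distribˡ-* (ℤ.+ suc m) j)) ⟩
    fromℤ (ℤ.- (ℤ.+ suc m ℤ.* j))         ≡⟨ fromℤ-‿ (ℤ.+ suc m ℤ.* j) ⟩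
    - fromℤ (ℤ.+ suc m ℤ.* j)             ≡⟨ cong (λ x → - x) (fromℤ-+* (suc m) j) ⟩
    - (fromℕ (suc m) * fromℤ j)           ≡⟨ -‿distribˡ-* _ _ ⟩
    - fromℕ (suc m) * fromℤ j             ∎

  -- The solver reads a constant c as ⟦ c ⟧ℤ, which must compute to 0#, 1#
  -- and - 1# on the nose for solved equations to match goals literally.
  ⟦_⟧ℕ : ℕ → Carrier
  ⟦ zero        ⟧ℕ = 0#
  ⟦ suc zero    ⟧ℕ = 1#
  ⟦ suc (suc n) ⟧ℕ = 1# + ⟦ suc n ⟧ℕ

  ⟦⟧ℕ≡fromℕ : ∀ n → ⟦ n ⟧ℕ ≡ fromℕ n
  ⟦⟧ℕ≡fromℕ zero          = refl
  ⟦⟧ℕ≡fromℕ (suc zero)    = sym (+-idʳ 1#)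
  ⟦⟧ℕ≡fromℕ (suc (suc n)) = cong (1# +_) (⟦⟧ℕ≡fromℕ (suc n))

  ⟦_⟧ℤ : ℤ → Carrier
  ⟦ ℤ.+ n    ⟧ℤ = ⟦ n ⟧ℕ
  ⟦ ℤ.-[1+ n ] ⟧ℤ = - ⟦ suc n ⟧ℕ

  ⟦⟧ℤ≡fromℤ : ∀ i → ⟦ i ⟧ℤ ≡ fromℤ i
  ⟦⟧ℤ≡fromℤ (ℤ.+ n)    = ⟦⟧ℕ≡fromℕ n
  ⟦⟧ℤ≡fromℤ ℤ.-[1+ n ] = cong (λ x → - x) (⟦⟧ℕ≡fromℕ (suc n))

  private
    ℤ-rawRing : RawRing _ _
    ℤ-rawRing = record
      { Carrier = ℤ ; _≈_ = _≡_ ; _+_ = ℤ._+_ ; _*_ = ℤ._*_ ; -_ = ℤ.-_ ; 0# = ℤ.0ℤ ; 1# = ℤ.1ℤ }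

    almostCommutativeRing : ACR.AlmostCommutativeRing _ _
    almostCommutativeRing = ACR.fromCommutativeRing commutativeRing

    ⟦⟧ℤ-homo : ∀ (f : ℤ → ℤ → ℤ) (g : Carrier → Carrier → Carrier) →
              (∀ i j → fromℤ (f i j) ≡ g (fromℤ i) (fromℤ j)) →
              ∀ i j → ⟦ f i j ⟧ℤ ≡ g ⟦ i ⟧ℤ ⟦ j ⟧ℤ
    ⟦⟧ℤ-homo f g fromℤ-homo i j = begin
      ⟦ f i j ⟧ℤ                  ≡⟨ ⟦⟧ℤ≡fromℤ (f i j) ⟩
      fromℤ (f i j)              ≡⟨ fromℤ-homo i j ⟩
      g (fromℤ i) (fromℤ j)      ≡⟨ sym (cong₂ g (⟦⟧ℤ≡fromℤ i) (⟦⟧ℤ≡fromℤ j)) ⟩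
      g ⟦ i ⟧ℤ ⟦ j ⟧ℤ              ∎

    homomorphism : ℤ-rawRing ACR.-Raw-AlmostCommutative⟶ almostCommutativeRing
    homomorphism = record
      { ⟦_⟧    = ⟦_⟧ℤ
      ; +-homo = ⟦⟧ℤ-homo ℤ._+_ _+_ fromℤ-+
      ; *-homo = ⟦⟧ℤ-homo ℤ._*_ _*_ fromℤ-*
      ; -‿homo = λ i →
          trans (⟦⟧ℤ≡fromℤ (ℤ.- i)) (trans (fromℤ-‿ i) (cong (λ x → - x) (sym (⟦⟧ℤ≡fromℤ i))))
      ; 0-homo = refl
      ; 1-homo = refl
      }

    ⟦⟧ℤ-≟ : ∀ i j → Maybe (⟦ i ⟧ℤ ≡ ⟦ j ⟧ℤ)
    ⟦⟧ℤ-≟ i j with i ℤ.≟ j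
    ... | yes refl = just refl
    ... | no  _    = nothing

  open Algebra.Solver.Ring ℤ-rawRing almostCommutativeRing homomorphism ⟦⟧ℤ-≟ public

-- An equation x ≡ y follows from hypotheses pᵢ ≡ qᵢ once x - y is written
-- as Σ cᵢ * (pᵢ - qᵢ); the ring solver certifies that identity.
module Combination (R : RealField) where
  open RealField R
  open FieldProperties R

  infixl 6 _⊞_

  by-combination : ∀ {x y z} → x - y ≡ z → z ≡ 0# → x ≡ y
  by-combination x-y≡z z≡0 = x-y≡0⇒x≡y (trans x-y≡z z≡0)

  vanishes : ∀ {c x y} → x ≡ y → c * (x - y) ≡ 0#
  vanishes {c} {x} refl = trans (cong (c *_) (+-invʳ x)) (zeroʳ c)

  _⊞_ : ∀ {x y} → x ≡ 0# → y ≡ 0# → x + y ≡ 0#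
  refl ⊞ refl = +-idʳ 0#

module Equations (R : RealField) where
  open RealField R
  open FieldProperties R
  open IntegerSolver R
  open Combination R

  Recurrence : (c a b θ x₋ x x₊ : Carrier) → Set
  Recurrence c a b θ x₋ x x₊ = c * x₋ + a * x + b * x₊ ≡ θ * x

  Linked : (e x₋ x y₋ y : Carrier) → Set
  Linked e x₋ x y₋ y = x * y - x₋ * y₋ ≡ e * (x₋ * y - x * y₋)

  recurrenceₑ : ∀ {n} (c a b θ x₋ x x₊ : Polynomial n) → Polynomial n
  recurrenceₑ c a b θ x₋ x x₊ = c :* x₋ :+ a :* x :+ b :* x₊ :- θ :* x

  linkedₑ : ∀ {n} (e x₋ x y₋ y : Polynomial n) → Polynomial n
  linkedₑ e x₋ x y₋ y = x :* y :- x₋ :* y₋ :- e :* (x₋ :* y :- x :* y₋)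

  θ≡kx₁ : ∀ {a k θ x₀ x₁} → a ≡ 0# → x₀ ≡ 1# → 0# + a * x₀ + k * x₁ ≡ θ * x₀ → θ ≡ k * x₁
  θ≡kx₁ {a} {k} {θ} {x₀} {x₁} a≡0 x₀≡1 rec = by-combination
    (solve 5 (λ a k θ x₀ x₁ →
       θ :- (k :* x₁)
       := x₀ :* (a :- con 0ℤ)
          :+ :- θ :* (x₀ :- con 1ℤ)
          :+ con -1ℤ :* (con 0ℤ :+ a :* x₀ :+ k :* x₁ :- θ :* x₀)) refl a k θ x₀ x₁)
    (vanishes a≡0 ⊞ vanishes x₀≡1 ⊞ vanishes rec)

  Linked-swap : ∀ {e x₋ x y₋ y} → Linked e x₋ x y₋ y → Linked (- e) y₋ y x₋ x
  Linked-swap {e} {x₋} {x} {y₋} {y} link = by-combination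
    (solve 5 (λ e x₋ x y₋ y →
       y :* x :- y₋ :* x₋ :- (:- e :* (y₋ :* x :- y :* x₋))
       := con 1ℤ :* linkedₑ e x₋ x y₋ y) refl e x₋ x y₋ y)
    (vanishes link)

  recurrence-zeros : ∀ {c a b θ x₋ x x₊} → x ≡ 0# → x₊ ≡ 0# → Recurrence c a b θ x₋ x x₊ →
      c * x₋ ≡ 0#
  recurrence-zeros {c} {a} {b} {θ} {x₋} {x} {x₊} x≡0 x₊≡0 rec = by-combination
    (solve 7 (λ c a b θ x₋ x x₊ →
       c :* x₋ :- con 0ℤ
       := (θ :- a) :* (x :- con 0ℤ)
          :+ :- b :* (x₊ :- con 0ℤ)
          :+ con 1ℤ :* recurrenceₑ c a b θ x₋ x x₊) refl c a b θ x₋ x x₊)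
    (vanishes x≡0 ⊞ vanishes x₊≡0 ⊞ vanishes rec)

  a+a≡0 : ∀ {a b x} → x ≡ 1# → b * (x - 1#) ≡ a + a → a + a ≡ 0#
  a+a≡0 {a} {b} {x} x≡1 eq = by-combination
    (solve 3 (λ a b x →
       a :+ a :- con 0ℤ
       := b :* (x :- con 1ℤ)
          :+ con -1ℤ :* (b :* (x :- con 1ℤ) :- (a :+ a))) refl a b x)
    (vanishes x≡1 ⊞ vanishes eq)

  [a₁+a₁][a₂+a₂+c₂]+[a₂+a₂]b₁≡0 : ∀ {a₁ b₁ a₂ c₂ x} → b₁ * (x - 1#) ≡ a₁ + a₁ →
      x * (a₂ + a₂ + c₂) ≡ c₂ → (a₁ + a₁) * (a₂ + a₂ + c₂) + (a₂ + a₂) * b₁ ≡ 0#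
  [a₁+a₁][a₂+a₂+c₂]+[a₂+a₂]b₁≡0 {a₁} {b₁} {a₂} {c₂} {x} eq₁ eq₂ = by-combination
    (solve 5 (λ a₁ b₁ a₂ c₂ x →
       (a₁ :+ a₁) :* (a₂ :+ a₂ :+ c₂) :+ (a₂ :+ a₂) :* b₁ :- con 0ℤ
       := :- (a₂ :+ a₂ :+ c₂) :* (b₁ :* (x :- con 1ℤ) :- (a₁ :+ a₁))
          :+ b₁ :* (x :* (a₂ :+ a₂ :+ c₂) :- c₂)) refl a₁ b₁ a₂ c₂ x)
    (vanishes eq₁ ⊞ vanishes eq₂)

  y₁≡1 : ∀ {b y₁ y₊} → y₊ ≡ y₁ → b * (y₊ - y₁) ≡ 1# - y₁ → y₁ ≡ 1#
  y₁≡1 {b} {y₁} {y₊} y₊≡y₁ eq = by-combination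
    (solve 3 (λ b y₁ y₊ →
       y₁ :- con 1ℤ
       := :- b :* (y₊ :- y₁)
          :+ con 1ℤ :* (b :* (y₊ :- y₁) :- (con 1ℤ :- y₁))) refl b y₁ y₊)
    (vanishes y₊≡y₁ ⊞ vanishes eq)

  [x-1][x+1]≡0 : ∀ {x z} → z ≡ 1# → x * x - z ≡ 0# → (x - 1#) * (x - - 1#) ≡ 0#
  [x-1][x+1]≡0 {x} {z} z≡1 eq = by-combination
    (solve 2 (λ x z →
       (x :- con 1ℤ) :* (x :- :- con 1ℤ) :- con 0ℤ
       := con 1ℤ :* (z :- con 1ℤ)
          :+ con 1ℤ :* (x :* x :- z :- con 0ℤ)) refl x z)
    (vanishes z≡1 ⊞ vanishes eq)

  eliminate-k : ∀ {a k e x₁ x₋ x x₊ z} →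
      a * (x₋ - x) * (x₊ - x) * (x₁ - e) ≡ k * (1# - e) * (x₊ - x₁ * x) * (x₋ - x₁ * x) →
      k * ((x₁ * x₁ - z) * (1# - e * x₁)) ≡ (x₁ - e) * (z - 1#) →
      (x₁ - e) * (a * ((x₊ - x) * (x₋ - x)) * ((x₁ * x₁ - z) * (1# - e * x₁)))
      ≡ (x₁ - e) * ((e - 1#) * (1# - z) * ((x₊ - x₁ * x) * (x₋ - x₁ * x)))
  eliminate-k {a} {k} {e} {x₁} {x₋} {x} {x₊} {z} formula kh = by-combination
    (solve 8 (λ a k e x₁ x₋ x x₊ z →
       (x₁ :- e) :* (a :* ((x₊ :- x) :* (x₋ :- x)) :* ((x₁ :* x₁ :- z) :* (con 1ℤ :- e :* x₁)))
           :- ((x₁ :- e) :*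
           ((e :- con 1ℤ) :* (con 1ℤ :- z) :* ((x₊ :- x₁ :* x) :* (x₋ :- x₁ :* x))))
       := (x₁ :* x₁ :- z) :* (con 1ℤ :- e :* x₁)
           :* (a :* (x₋ :- x) :* (x₊ :- x) :* (x₁ :- e)
           :- k :* (con 1ℤ :- e) :* (x₊ :- x₁ :* x) :* (x₋ :- x₁ :* x))
          :+ (con 1ℤ :- e) :* ((x₊ :- x₁ :* x) :* (x₋ :- x₁ :* x))
              :* (k :* ((x₁ :* x₁ :- z) :* (con 1ℤ :- e :* x₁)) :- (x₁ :- e) :* (z :- con 1ℤ))) refl
              a k e x₁ x₋ x x₊ z)
    (vanishes formula ⊞ vanishes kh)

  a*y*d≡n*x⇒a≡n/d*x/y : ∀ {a y d n x} → y ≢ 0# → d ≢ 0# → a * y * d ≡ n * x →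
                         a ≡ n * d ⁻¹ * (x * y ⁻¹)
  a*y*d≡n*x⇒a≡n/d*x/y {a} {y} {d} {n} {x} y≢0 d≢0 ayd≡nx = sym (begin
    n * d ⁻¹ * (x * y ⁻¹)        ≡⟨ regroup₁ ⟩
    n * x * (d ⁻¹ * y ⁻¹)        ≡⟨ cong (_* (d ⁻¹ * y ⁻¹)) (sym ayd≡nx) ⟩
    a * y * d * (d ⁻¹ * y ⁻¹)    ≡⟨ regroup₂ ⟩
    a * (y * y ⁻¹) * (d * d ⁻¹)  ≡⟨ cong₂ (λ u v → a * u * v) (*-invʳ y y≢0) (*-invʳ d d≢0) ⟩
    a * 1# * 1#                  ≡⟨ trans (*-idʳ _) (*-idʳ a) ⟩
    a                            ∎)
    where
    open ≡-Reasoning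
    regroup₁ : n * d ⁻¹ * (x * y ⁻¹) ≡ n * x * (d ⁻¹ * y ⁻¹)
    regroup₁ = solve 4 (λ n d′ x y′ → n :* d′ :* (x :* y′) := n :* x :* (d′ :* y′))
                       refl n (d ⁻¹) x (y ⁻¹)
    regroup₂ : a * y * d * (d ⁻¹ * y ⁻¹) ≡ a * (y * y ⁻¹) * (d * d ⁻¹)
    regroup₂ = solve 5 (λ a y d d′ y′ → a :* y :* d :* (d′ :* y′) := a :* (y :* y′) :* (d :* d′))
                       refl a y d (d ⁻¹) (y ⁻¹)

-- The data around one index i: cᵢ, aᵢ, bᵢ, k, the first terms x₁, y₁ and
-- the parameter e of two sequences, and their values x₋ x x₊ and y₋ y y₊
-- at i - 1, i, i + 1.  Every lemma is a polynomial consequence of the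
-- local equations, certified on these thirteen variables.
module Window (R : RealField) (c a b k x₁ y₁ e x₋ x x₊ y₋ y y₊ : RealField.Carrier R) where
  open RealField R
  open IntegerSolver R
  open Combination R
  open Equations R

  private
    environment : Vec Carrier 13
    environment = c ∷ a ∷ b ∷ k ∷ x₁ ∷ y₁ ∷ e ∷ x₋ ∷ x ∷ x₊ ∷ y₋ ∷ y ∷ y₊ ∷ []

    Equation : Set _
    Equation = N-ary 13 (Polynomial 13) (Polynomial 13 × Polynomial 13)

    sides : Equation → Polynomial 13 × Polynomial 13
    sides f = f $ⁿ Vec.map var (Vec.allFin 13)

    solve-window : (f : Equation) →
                   ⟦ proj₁ (sides f) ⟧↓ environment ≡ ⟦ proj₂ (sides f) ⟧↓ environment →
                   ⟦ proj₁ (sides f) ⟧ environment ≡ ⟦ proj₂ (sides f) ⟧ environment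
    solve-window f = prove environment (proj₁ (sides f)) (proj₂ (sides f))

  Sum Recˣ Recʸ Recˣʸ Link Link₊ Start Formula : Set
  Sum     = k ≡ c + a + b
  Recˣ    = Recurrence c a b (k * x₁) x₋ x x₊
  Recʸ    = Recurrence c a b (k * y₁) y₋ y y₊
  Recˣʸ   = Recurrence c a b (k * (x₁ * y₁)) (x₋ * y₋) (x * y) (x₊ * y₊)
  Link    = Linked e x₋ x y₋ y
  Link₊   = Linked e x x₊ y y₊
  Start   = x₁ * y₁ - 1# ≡ e * (y₁ - x₁)
  Formula = a * (x₋ - x) * (x₊ - x) * (x₁ - e) ≡ k * (1# - e) * (x₊ - x₁ * x) * (x₋ - x₁ * x)

  -- Eliminating y₋, y₊ (linking relations), a (Sum) and y₁ (Start) from the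
  -- recurrences and dividing by y leaves F₂ = 0 and F₄ = 0, two equations
  -- linear in c and b.

  δ₋ δ₊ F₂ F₄ : Carrier
  δ₋ = x₋ - e * x
  δ₊ = x₊ - e * x
  F₂ = (x₁ - e) * (c * (x₋ - x) * δ₊ + b * (x₊ - x) * δ₋) + k * (1# - x₁) * (δ₋ * δ₊)
  F₄ = (x₁ - e) * (c * (x₋ - x) * δ₊ * (x₋ - x) + b * (x₊ - x) * δ₋ * (x₊ - x))
       - k * (1# - x₁) * (1# - x₁) * x * (δ₋ * δ₊)

  link⇒start : x₋ ≡ 1# → y₋ ≡ 1# → x ≡ x₁ → y ≡ y₁ → Link → Start
  link⇒start x₋≡1 y₋≡1 x≡x₁ y≡y₁ link = by-combination
    (solve-window (λ c a b k x₁ y₁ e x₋ x x₊ y₋ y y₊ →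
       x₁ :* y₁ :- con 1ℤ :- (e :* (y₁ :- x₁))
       := (e :* y :+ y₋) :* (x₋ :- con 1ℤ)
          :+ :- (con -1ℤ :+ e :* x) :* (y₋ :- con 1ℤ)
          :+ :- (y :+ e) :* (x :- x₁)
          :+ (e :- x₁) :* (y :- y₁)
          :+ con 1ℤ :* linkedₑ e x₋ x y₋ y) refl)
    (vanishes x₋≡1 ⊞ vanishes y₋≡1 ⊞ vanishes x≡x₁ ⊞ vanishes y≡y₁ ⊞ vanishes link)

  start⇒y₁[x₁-e]≡1-ex₁ : Start → y₁ * (x₁ - e) ≡ 1# - e * x₁
  start⇒y₁[x₁-e]≡1-ex₁ start = by-combination
    (solve-window (λ c a b k x₁ y₁ e x₋ x x₊ y₋ y y₊ →
       y₁ :* (x₁ :- e) :- (con 1ℤ :- e :* x₁)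
       := con 1ℤ :* (x₁ :* y₁ :- con 1ℤ :- e :* (y₁ :- x₁))) refl)
    (vanishes start)

  e≡x₁⇒[x₁-1][x₁+1]≡0 : e ≡ x₁ → Start → (x₁ - 1#) * (x₁ - - 1#) ≡ 0#
  e≡x₁⇒[x₁-1][x₁+1]≡0 e≡x₁ start = by-combination
    (solve-window (λ c a b k x₁ y₁ e x₋ x x₊ y₋ y y₊ →
       (x₁ :- con 1ℤ) :* (x₁ :- :- con 1ℤ) :- con 0ℤ
       := (y₁ :- x₁) :* (e :- x₁)
          :+ con 1ℤ :* (x₁ :* y₁ :- con 1ℤ :- e :* (y₁ :- x₁))) refl)
    (vanishes e≡x₁ ⊞ vanishes start)

  e≡-1⇒[y₁-1][x₁+1]≡0 : e ≡ - 1# → Start → (y₁ - 1#) * (x₁ - - 1#) ≡ 0#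
  e≡-1⇒[y₁-1][x₁+1]≡0 e≡-1 start = by-combination
    (solve-window (λ c a b k x₁ y₁ e x₋ x x₊ y₋ y y₊ →
       (y₁ :- con 1ℤ) :* (x₁ :- :- con 1ℤ) :- con 0ℤ
       := (y₁ :- x₁) :* (e :- (:- con 1ℤ))
          :+ con 1ℤ :* (x₁ :* y₁ :- con 1ℤ :- e :* (y₁ :- x₁))) refl)
    (vanishes e≡-1 ⊞ vanishes start)

  b[x₊-1]≡a+a : Sum → c ≡ 1# → x₋ ≡ 1# → x ≡ x₁ → x₁ ≡ - 1# → Recˣ → b * (x₊ - 1#) ≡ a + a
  b[x₊-1]≡a+a sum c≡1 x₋≡1 x≡x₁ x₁≡-1 recˣ = by-combination
    (solve-window (λ c a b k x₁ y₁ e x₋ x x₊ y₋ y y₊ →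
       b :* (x₊ :- con 1ℤ) :- (a :+ a)
       := x₁ :* x :* (k :- (c :+ a :+ b))
          :+ (x₁ :* x :- x₋) :* (c :- con 1ℤ)
          :+ con -1ℤ :* (x₋ :- con 1ℤ)
          :+ ((con 1ℤ :+ a :+ b) :* x₁ :- a) :* (x :- x₁)
          :+ ((con 1ℤ :+ a :+ b) :* x₁ :- (con 1ℤ :+ a :+ b) :- a) :* (x₁ :- (:- con 1ℤ))
          :+ con 1ℤ :* recurrenceₑ c a b (k :* x₁) x₋ x x₊) refl)
    (vanishes sum ⊞ vanishes c≡1 ⊞ vanishes x₋≡1 ⊞ vanishes x≡x₁ ⊞ vanishes x₁≡-1 ⊞ vanishes recˣ)

  e≡-1⇒[x-1][y-y₋]≡0 : e ≡ - 1# → x₋ ≡ - 1# → Link → (x - 1#) * (y - y₋) ≡ 0#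
  e≡-1⇒[x-1][y-y₋]≡0 e≡-1 x₋≡-1 link = by-combination
    (solve-window (λ c a b k x₁ y₁ e x₋ x x₊ y₋ y y₊ →
       (x :- con 1ℤ) :* (y :- y₋) :- con 0ℤ
       := (x₋ :* y :- x :* y₋) :* (e :- (:- con 1ℤ))
          :+ (y₋ :- y) :* (x₋ :- (:- con 1ℤ))
          :+ con 1ℤ :* linkedₑ e x₋ x y₋ y) refl)
    (vanishes e≡-1 ⊞ vanishes x₋≡-1 ⊞ vanishes link)

  [y₁-1][ky₁+1]≡0 : Sum → c ≡ 1# → y₋ ≡ 1# → y ≡ y₁ → y₊ ≡ y₁ → Recʸ →
      (y₁ - 1#) * (k * y₁ + 1#) ≡ 0#
  [y₁-1][ky₁+1]≡0 sum c≡1 y₋≡1 y≡y₁ y₊≡y₁ recʸ = by-combination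
    (solve-window (λ c a b k x₁ y₁ e x₋ x x₊ y₋ y y₊ →
       (y₁ :- con 1ℤ) :* (k :* y₁ :+ con 1ℤ) :- con 0ℤ
       := ((y₁ :- con 1ℤ) :* y₁ :- y₁ :* y) :* (k :- (c :+ a :+ b))
          :+ ((y₁ :- con 1ℤ) :* y₁ :- (y₁ :* y :- y₋)) :* (c :- con 1ℤ)
          :+ con 1ℤ :* (y₋ :- con 1ℤ)
          :+ (a :- (con 1ℤ :+ a :+ b) :* y₁) :* (y :- y₁)
          :+ b :* (y₊ :- y₁)
          :+ con -1ℤ :* recurrenceₑ c a b (k :* y₁) y₋ y y₊) refl)
    (vanishes sum ⊞ vanishes c≡1 ⊞ vanishes y₋≡1 ⊞ vanishes y≡y₁ ⊞ vanishes y₊≡y₁ ⊞ vanishes recʸ)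

  b[y₊-y₁]≡1-y₁ : Sum → y₋ ≡ y₁ → y ≡ y₁ → k * y₁ + 1# ≡ 0# → Recʸ → b * (y₊ - y₁) ≡ 1# - y₁
  b[y₊-y₁]≡1-y₁ sum y₋≡y₁ y≡y₁ ky₁+1≡0 recʸ = by-combination
    (solve-window (λ c a b k x₁ y₁ e x₋ x x₊ y₋ y y₊ →
       b :* (y₊ :- y₁) :- (con 1ℤ :- y₁)
       := (:- ((y₁ :- con 1ℤ) :* y₁) :+ y₁ :* y) :* (k :- (c :+ a :+ b))
          :+ :- c :* (y₋ :- y₁)
          :+ ((c :+ a :+ b) :* y₁ :- a) :* (y :- y₁)
          :+ (y₁ :- con 1ℤ) :* (k :* y₁ :+ con 1ℤ :- con 0ℤ)
          :+ con 1ℤ :* recurrenceₑ c a b (k :* y₁) y₋ y y₊) refl)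
    (vanishes sum ⊞ vanishes y₋≡y₁ ⊞ vanishes y≡y₁ ⊞ vanishes ky₁+1≡0 ⊞ vanishes recʸ)

  e≡-1⇒[y₊-y][x₊+x]≡0 : e ≡ - 1# → Link₊ → (y₊ - y) * (x₊ - - x) ≡ 0#
  e≡-1⇒[y₊-y][x₊+x]≡0 e≡-1 link₊ = by-combination
    (solve-window (λ c a b k x₁ y₁ e x₋ x x₊ y₋ y y₊ →
       (y₊ :- y) :* (x₊ :- :- x) :- con 0ℤ
       := (x :* y₊ :- x₊ :* y) :* (e :- (:- con 1ℤ))
          :+ con 1ℤ :* linkedₑ e x x₊ y y₊) refl)
    (vanishes e≡-1 ⊞ vanishes link₊)

  x[a+a+c]≡c : Sum → x₋ ≡ - 1# → x₁ ≡ - 1# → x₊ ≡ - x → Recˣ → x * (a + a + c) ≡ c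
  x[a+a+c]≡c sum x₋≡-1 x₁≡-1 x₊≡-x recˣ = by-combination
    (solve-window (λ c a b k x₁ y₁ e x₋ x x₊ y₋ y y₊ →
       x :* (a :+ a :+ c) :- c
       := x₁ :* x :* (k :- (c :+ a :+ b))
          :+ :- c :* (x₋ :- (:- con 1ℤ))
          :+ (c :+ a :+ b) :* x :* (x₁ :- (:- con 1ℤ))
          :+ :- b :* (x₊ :- (:- x))
          :+ con 1ℤ :* recurrenceₑ c a b (k :* x₁) x₋ x x₊) refl)
    (vanishes sum ⊞ vanishes x₋≡-1 ⊞ vanishes x₁≡-1 ⊞ vanishes x₊≡-x ⊞ vanishes recˣ)

  k[x₁-1]x[y₋-y₁y]≡0 : Sum → x₊ ≡ x → Recˣ → Recʸ → Recˣʸ → k * (x₁ - 1#) * (x * (y₋ - y₁ * y)) ≡ 0#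
  k[x₁-1]x[y₋-y₁y]≡0 sum x₊≡x recˣ recʸ recˣʸ = by-combination
    (solve-window (λ c a b k x₁ y₁ e x₋ x x₊ y₋ y y₊ →
       k :* (x₁ :- con 1ℤ) :* (x :* (y₋ :- y₁ :* y)) :- con 0ℤ
       := ((x₁ :- con 1ℤ) :* (x :* (y₋ :- y₁ :* y)) :- y₋ :* (x₁ :* x) :- x :* (y₁ :* y)
           :+ x₁ :* y₁ :* (x :* y)) :* (k :- (c :+ a :+ b))
          :+ (y₋ :* b :- b :* y₊) :* (x₊ :- x)
          :+ :- y₋ :* recurrenceₑ c a b (k :* x₁) x₋ x x₊
          :+ :- x :* recurrenceₑ c a b (k :* y₁) y₋ y y₊
          :+ con 1ℤ :* recurrenceₑ c a b (k :* (x₁ :* y₁)) (x₋ :* y₋) (x :* y) (x₊ :* y₊)) refl)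
    (vanishes sum ⊞ vanishes x₊≡x ⊞ vanishes recˣ ⊞ vanishes recʸ ⊞ vanishes recˣʸ)

  [1-e]x[y₊-y]≡0 : x₊ ≡ x → Link₊ → (1# - e) * (x * (y₊ - y)) ≡ 0#
  [1-e]x[y₊-y]≡0 x₊≡x link₊ = by-combination
    (solve-window (λ c a b k x₁ y₁ e x₋ x x₊ y₋ y y₊ →
       (con 1ℤ :- e) :* (x :* (y₊ :- y)) :- con 0ℤ
       := :- (y₊ :+ e :* y) :* (x₊ :- x)
          :+ con 1ℤ :* linkedₑ e x x₊ y y₊) refl)
    (vanishes x₊≡x ⊞ vanishes link₊)

  [y₁-1][a+b]y≡0 : Sum → y₋ ≡ y₁ * y → y₊ ≡ y → Recʸ → (y₁ - 1#) * ((a + b) * y) ≡ 0#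
  [y₁-1][a+b]y≡0 sum y₋≡y₁y y₊≡y recʸ = by-combination
    (solve-window (λ c a b k x₁ y₁ e x₋ x x₊ y₋ y y₊ →
       (y₁ :- con 1ℤ) :* ((a :+ b) :* y) :- con 0ℤ
       := :- (y₁ :* y) :* (k :- (c :+ a :+ b))
          :+ c :* (y₋ :- (y₁ :* y))
          :+ b :* (y₊ :- y)
          :+ con -1ℤ :* recurrenceₑ c a b (k :* y₁) y₋ y y₊) refl)
    (vanishes sum ⊞ vanishes y₋≡y₁y ⊞ vanishes y₊≡y ⊞ vanishes recʸ)

  cy₋[x₊-x₋]≡0 : y ≡ 0# → Recʸ → Recˣʸ → c * y₋ * (x₊ - x₋) ≡ 0#
  cy₋[x₊-x₋]≡0 y≡0 recʸ recˣʸ = by-combination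
    (solve-window (λ c a b k x₁ y₁ e x₋ x x₊ y₋ y y₊ →
       c :* y₋ :* (x₊ :- x₋) :- con 0ℤ
       := (:- (x₊ :* (a :- k :* y₁)) :- (k :* (x₁ :* y₁) :* x :- a :* x)) :* (y :- con 0ℤ)
          :+ x₊ :* recurrenceₑ c a b (k :* y₁) y₋ y y₊
          :+ con -1ℤ :* recurrenceₑ c a b (k :* (x₁ :* y₁)) (x₋ :* y₋) (x :* y) (x₊ :* y₊)) refl)
    (vanishes y≡0 ⊞ vanishes recʸ ⊞ vanishes recˣʸ)

  y₋[x₋-ex]≡0 : y ≡ 0# → Link → y₋ * (x₋ - e * x) ≡ 0#
  y₋[x₋-ex]≡0 y≡0 link = by-combination
    (solve-window (λ c a b k x₁ y₁ e x₋ x x₊ y₋ y y₊ →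
       y₋ :* (x₋ :- e :* x) :- con 0ℤ
       := (x :- e :* x₋) :* (y :- con 0ℤ)
          :+ con -1ℤ :* linkedₑ e x₋ x y₋ y) refl)
    (vanishes y≡0 ⊞ vanishes link)

  formula-when-x₊≡x₋≡ex : x₊ ≡ x₋ → x₋ ≡ e * x → Sum → Recˣ → Formula
  formula-when-x₊≡x₋≡ex x₊≡x₋ x₋≡ex sum recˣ = by-combination
    (solve-window (λ c a b k x₁ y₁ e x₋ x x₊ y₋ y y₊ →
       a :* (x₋ :- x) :* (x₊ :- x) :* (x₁ :- e)
           :- (k :* (con 1ℤ :- e) :* (x₊ :- x₁ :* x) :* (x₋ :- x₁ :* x))
       := (a :* (x₋ :- x) :* (x₁ :- e) :- k :* (con 1ℤ :- e) :* (x₋ :- x₁ :* x)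
           :- x :* (con 1ℤ :- e) :* (x₁ :- e) :* b) :* (x₊ :- x₋)
          :+ ((a :* (x₋ :- x) :+ a :* (e :* x :- x)) :* (x₁ :- e)
              :- (k :* (con 1ℤ :- e) :* (x₋ :- x₁ :* x)
              :+ k :* (con 1ℤ :- e) :* (e :* x :- x₁ :* x))
              :- x :* (con 1ℤ :- e) :* (x₁ :- e) :* (c :+ b)) :* (x₋ :- (e :* x))
          :+ (:- ((con 1ℤ :- e) :* (e :* x :- x₁ :* x) :* (e :* x :- x₁ :* x))
              :+ x :* (con 1ℤ :- e) :* (x₁ :- e) :* (x₁ :* x)) :* (k :- (c :+ a :+ b))
          :+ x :* (con 1ℤ :- e) :* (x₁ :- e) :* recurrenceₑ c a b (k :* x₁) x₋ x x₊) refl)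
    (vanishes x₊≡x₋ ⊞ vanishes x₋≡ex ⊞ vanishes sum ⊞ vanishes recˣ)

  formula-when-x₊≡x₋≡x₁x : x₊ ≡ x₋ → x₋ ≡ x₁ * x → Sum → Recˣ → Formula
  formula-when-x₊≡x₋≡x₁x x₊≡x₋ x₋≡x₁x sum recˣ = by-combination
    (solve-window (λ c a b k x₁ y₁ e x₋ x x₊ y₋ y y₊ →
       a :* (x₋ :- x) :* (x₊ :- x) :* (x₁ :- e)
           :- (k :* (con 1ℤ :- e) :* (x₊ :- x₁ :* x) :* (x₋ :- x₁ :* x))
       := (a :* (x₋ :- x) :* (x₁ :- e) :- k :* (con 1ℤ :- e) :* (x₋ :- x₁ :* x)
           :- x :* (con 1ℤ :- x₁) :* (x₁ :- e) :* b) :* (x₊ :- x₋)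
          :+ ((a :* (x₋ :- x) :+ a :* (x₁ :* x :- x)) :* (x₁ :- e)
              :- (k :* (con 1ℤ :- e) :* (x₋ :- x₁ :* x)
              :+ k :* (con 1ℤ :- e) :* (x₁ :* x :- x₁ :* x))
              :- x :* (con 1ℤ :- x₁) :* (x₁ :- e) :* (c :+ b)) :* (x₋ :- (x₁ :* x))
          :+ (:- ((con 1ℤ :- e) :* (x₁ :* x :- x₁ :* x) :* (x₁ :* x :- x₁ :* x))
              :+ x :* (con 1ℤ :- x₁) :* (x₁ :- e) :* (x₁ :* x)) :* (k :- (c :+ a :+ b))
          :+ x :* (con 1ℤ :- x₁) :* (x₁ :- e) :* recurrenceₑ c a b (k :* x₁) x₋ x x₊) refl)
    (vanishes x₊≡x₋ ⊞ vanishes x₋≡x₁x ⊞ vanishes sum ⊞ vanishes recˣ)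

  yx[1-e][e+1]≡0 : x₋ ≡ e * x → Link → y * x * ((1# - e) * (e - - 1#)) ≡ 0#
  yx[1-e][e+1]≡0 x₋≡ex link = by-combination
    (solve-window (λ c a b k x₁ y₁ e x₋ x x₊ y₋ y y₊ →
       y :* x :* ((con 1ℤ :- e) :* (e :- :- con 1ℤ)) :- con 0ℤ
       := (e :* y :+ y₋) :* (x₋ :- (e :* x))
          :+ con 1ℤ :* linkedₑ e x₋ x y₋ y) refl)
    (vanishes x₋≡ex ⊞ vanishes link)

  yx[1-e][e+1]≡0₊ : x₊ ≡ e * x → Link₊ → y * x * ((1# - e) * (e - - 1#)) ≡ 0#
  yx[1-e][e+1]≡0₊ x₊≡ex link₊ = by-combination
    (solve-window (λ c a b k x₁ y₁ e x₋ x x₊ y₋ y y₊ →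
       y :* x :* ((con 1ℤ :- e) :* (e :- :- con 1ℤ)) :- con 0ℤ
       := (y₊ :+ e :* y) :* (x₊ :- (e :* x))
          :+ con -1ℤ :* linkedₑ e x x₊ y y₊) refl)
    (vanishes x₊≡ex ⊞ vanishes link₊)

  y[e+1]F₂≡0 : Sum → Recʸ → Link → Link₊ → Start → y * (e - - 1#) * F₂ ≡ 0#
  y[e+1]F₂≡0 sum recʸ link link₊ start = by-combination
    (solve-window (λ c a b k x₁ y₁ e x₋ x x₊ y₋ y y₊ →
       y :* (e :- :- con 1ℤ)
           :* ((x₁ :- e) :* (c :* (x₋ :- x) :* (x₊ :- e :* x) :+ b :* (x₊ :- x) :* (x₋ :- e :* x))
           :+ k :* (con 1ℤ :- x₁) :* ((x₋ :- e :* x) :* (x₊ :- e :* x))) :- con 0ℤ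
       := :- (x₁ :- e) :* ((x₋ :- e :* x) :* (x₊ :- e :* x)) :* y :* (k :- (c :+ a :+ b))
          :+ :- (x₁ :- e) :* ((x₋ :- e :* x) :* (x₊ :- e :* x))
              :* recurrenceₑ c a b (k :* y₁) y₋ y y₊
          :+ :- (x₁ :- e) :* c :* (x₊ :- e :* x) :* linkedₑ e x₋ x y₋ y
          :+ (x₁ :- e) :* b :* (x₋ :- e :* x) :* linkedₑ e x x₊ y y₊
          :+ :- k :* y :* ((x₋ :- e :* x) :* (x₊ :- e :* x))
              :* (x₁ :* y₁ :- con 1ℤ :- e :* (y₁ :- x₁))) refl)
    (vanishes sum ⊞ vanishes recʸ ⊞ vanishes link ⊞ vanishes link₊ ⊞ vanishes start)

  y[e+1]F₄≡0 : Sum → Recˣ → Recʸ → Recˣʸ → Link → Link₊ → Start → y * (e - - 1#) * F₄ ≡ 0#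
  y[e+1]F₄≡0 sum recˣ recʸ recˣʸ link link₊ start = by-combination
    (solve-window (λ c a b k x₁ y₁ e x₋ x x₊ y₋ y y₊ →
       y :* (e :- :- con 1ℤ)
           :* ((x₁ :- e) :*
           (c :* (x₋ :- x) :* (x₊ :- e :* x) :* (x₋ :- x)
           :+ b :* (x₊ :- x) :* (x₋ :- e :* x) :* (x₊ :- x))
           :- k :* (con 1ℤ :- x₁) :* (con 1ℤ :- x₁) :* x :* ((x₋ :- e :* x) :* (x₊ :- e :* x)))
           :- con 0ℤ
       := (x₁ :- e) :* ((x₋ :- e :* x) :* (x₊ :- e :* x)) :* x :* y :* (k :- (c :+ a :+ b))
          :+ (x₁ :- e) :* ((x₋ :- e :* x) :* (x₊ :- e :* x)) :* y
              :* recurrenceₑ c a b (k :* x₁) x₋ x x₊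
          :+ (x₁ :- e) :* ((x₋ :- e :* x) :* (x₊ :- e :* x)) :* x
              :* recurrenceₑ c a b (k :* y₁) y₋ y y₊
          :+ :- (x₁ :- e) :* ((x₋ :- e :* x) :* (x₊ :- e :* x))
              :* recurrenceₑ c a b (k :* (x₁ :* y₁)) (x₋ :* y₋) (x :* y) (x₊ :* y₊)
          :+ :- (x₁ :- e) :* (x₋ :- x) :* c :* (x₊ :- e :* x) :* linkedₑ e x₋ x y₋ y
          :+ (x₁ :- e) :* (x₊ :- x) :* b :* (x₋ :- e :* x) :* linkedₑ e x x₊ y y₊
          :+ k :* (con 1ℤ :- x₁) :* x :* y :* ((x₋ :- e :* x) :* (x₊ :- e :* x))
              :* (x₁ :* y₁ :- con 1ℤ :- e :* (y₁ :- x₁))) refl)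
    (vanishes sum ⊞ vanishes recˣ ⊞ vanishes recʸ ⊞ vanishes recˣʸ ⊞ vanishes link ⊞ vanishes link₊
        ⊞ vanishes start)

  formula×δ₋δ₊[x₊-x₋] : Sum → F₂ ≡ 0# → F₄ ≡ 0# →
      a * (x₋ - x) * (x₊ - x) * (x₁ - e) * (δ₋ * δ₊ * (x₊ - x₋))
      ≡ k * (1# - e) * (x₊ - x₁ * x) * (x₋ - x₁ * x) * (δ₋ * δ₊ * (x₊ - x₋))
  formula×δ₋δ₊[x₊-x₋] sum F₂≡0 F₄≡0 = by-combination
    (solve-window (λ c a b k x₁ y₁ e x₋ x x₊ y₋ y y₊ →
       a :* (x₋ :- x) :* (x₊ :- x) :* (x₁ :- e) :* ((x₋ :- e :* x) :* (x₊ :- e :* x) :* (x₊ :- x₋))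
           :- (k :* (con 1ℤ :- e) :* (x₊ :- x₁ :* x) :* (x₋ :- x₁ :* x)
           :* ((x₋ :- e :* x) :* (x₊ :- e :* x) :* (x₊ :- x₋)))
       := :- (x₋ :- x) :* (x₊ :- x) :* (x₁ :- e) :* ((x₋ :- e :* x) :* (x₊ :- e :* x) :* (x₊ :- x₋))
           :* (k :- (c :+ a :+ b))
          :+ ((x₋ :- x) :* (x₊ :- e :* x) :* (x₋ :- x) :- (x₊ :- x) :* (x₋ :- e :* x) :* (x₊ :- x))
              :* ((x₁ :- e) :*
              (c :* (x₋ :- x) :* (x₊ :- e :* x) :+ b :* (x₊ :- x) :* (x₋ :- e :* x))
              :+ k :* (con 1ℤ :- x₁) :* ((x₋ :- e :* x) :* (x₊ :- e :* x)) :- con 0ℤ)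
          :+ (:- (x₋ :- x) :* (x₊ :- e :* x) :+ (x₊ :- x) :* (x₋ :- e :* x))
              :* ((x₁ :- e) :*
              (c :* (x₋ :- x) :* (x₊ :- e :* x) :* (x₋ :- x)
              :+ b :* (x₊ :- x) :* (x₋ :- e :* x) :* (x₊ :- x))
              :- k :* (con 1ℤ :- x₁) :* (con 1ℤ :- x₁) :* x :* ((x₋ :- e :* x) :* (x₊ :- e :* x))
              :- con 0ℤ)) refl)
    (vanishes sum ⊞ vanishes F₂≡0 ⊞ vanishes F₄≡0)

  k[1-x₁]δ₋δ₊[x₋-x₁x]≡0 : x₊ ≡ x₋ → F₂ ≡ 0# → F₄ ≡ 0# →
      k * (1# - x₁) * (δ₋ * δ₊) * (x₋ - x₁ * x) ≡ 0#
  k[1-x₁]δ₋δ₊[x₋-x₁x]≡0 x₊≡x₋ F₂≡0 F₄≡0 = by-combination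
    (solve-window (λ c a b k x₁ y₁ e x₋ x x₊ y₋ y y₊ →
       k :* (con 1ℤ :- x₁) :* ((x₋ :- e :* x) :* (x₊ :- e :* x)) :* (x₋ :- x₁ :* x) :- con 0ℤ
       := (k :* (con 1ℤ :- x₁) :* (x₋ :- e :* x) :* (x₋ :- x₁ :* x)
           :- (x₋ :- x) :* ((x₁ :- e) :* (c :* (x₋ :- x) :+ b :* (x₋ :- e :* x))
           :+ k :* (con 1ℤ :- x₁) :* (x₋ :- e :* x))
           :- (k :* (con 1ℤ :- x₁) :* (con 1ℤ :- x₁) :* x :* (x₋ :- e :* x)
           :- (x₁ :- e) :* (c :* (x₋ :- x) :* (x₋ :- x)
           :+ (b :* (x₋ :- e :* x) :* (x₊ :- x) :+ b :* (x₋ :- x) :* (x₋ :- e :* x)))))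
           :* (x₊ :- x₋)
          :+ (x₋ :- x) :* ((x₁ :- e)
              :* (c :* (x₋ :- x) :* (x₊ :- e :* x) :+ b :* (x₊ :- x) :* (x₋ :- e :* x))
              :+ k :* (con 1ℤ :- x₁) :* ((x₋ :- e :* x) :* (x₊ :- e :* x)) :- con 0ℤ)
          :+ con -1ℤ :* ((x₁ :- e)
              :* (c :* (x₋ :- x) :* (x₊ :- e :* x) :* (x₋ :- x)
              :+ b :* (x₊ :- x) :* (x₋ :- e :* x) :* (x₊ :- x))
              :- k :* (con 1ℤ :- x₁) :* (con 1ℤ :- x₁) :* x :* ((x₋ :- e :* x) :* (x₊ :- e :* x))
              :- con 0ℤ)) refl)
    (vanishes x₊≡x₋ ⊞ vanishes F₂≡0 ⊞ vanishes F₄≡0)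

  formula-at-1 : Sum → c ≡ 1# → x₋ ≡ 1# → x ≡ x₁ → Recˣ → Formula →
      (1# - x₁) * (k * ((x₁ * x₁ - x₊) * (1# - e * x₁))) ≡ (1# - x₁) * ((x₁ - e) * (x₊ - 1#))
  formula-at-1 sum c≡1 x₋≡1 x≡x₁ recˣ formula = by-combination
    (solve-window (λ c a b k x₁ y₁ e x₋ x x₊ y₋ y y₊ →
       (con 1ℤ :- x₁) :* (k :* ((x₁ :* x₁ :- x₊) :* (con 1ℤ :- e :* x₁)))
           :- ((con 1ℤ :- x₁) :* ((x₁ :- e) :* (x₊ :- con 1ℤ)))
       := ((con 1ℤ :- x₁) :* ((x₁ :* x₁ :- x₊) :* (con 1ℤ :- e :* x₁))
           :+ (x₁ :- e) :* (con 1ℤ :- x₁) :* (x₁ :* x)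
           :+ (con 1ℤ :- e) :* (x₊ :- x₁ :* x) :* (x₋ :- x₁ :* x)) :* (k :- (c :+ a :+ b))
          :+ ((con 1ℤ :- x₁) :* ((x₁ :* x₁ :- x₊) :* (con 1ℤ :- e :* x₁))
              :- (x₁ :- e) :* (con 1ℤ :- x₁) :* (x₋ :- x₁ :* x)
              :+ (con 1ℤ :- e) :* (x₊ :- x₁ :* x) :* (x₋ :- x₁ :* x)) :* (c :- con 1ℤ)
          :+ (:- ((x₁ :- e) :* (con 1ℤ :- x₁))
              :- (a :* (x₊ :- x) :* (x₁ :- e)
              :- (con 1ℤ :+ a :+ b) :* (con 1ℤ :- e) :* (x₊ :- x₁ :* x))) :* (x₋ :- con 1ℤ)
          :+ (:- ((x₁ :- e) :* (con 1ℤ :- x₁) :* (a :- (con 1ℤ :+ a :+ b) :* x₁))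
              :- ((:- (a :* (x₊ :- x)) :- a :* (con 1ℤ :- x₁)) :* (x₁ :- e)
              :- (:- ((con 1ℤ :+ a :+ b) :* (con 1ℤ :- e) :* x₁ :* (con 1ℤ :- x₁ :* x))
              :- (con 1ℤ :+ a :+ b) :* (con 1ℤ :- e) :* (x₊ :- x₁ :* x₁) :* x₁))) :* (x :- x₁)
          :+ (x₁ :- e) :* (con 1ℤ :- x₁) :* recurrenceₑ c a b (k :* x₁) x₋ x x₊
          :+ con 1ℤ :* (a :* (x₋ :- x) :* (x₊ :- x) :* (x₁ :- e)
              :- k :* (con 1ℤ :- e) :* (x₊ :- x₁ :* x) :* (x₋ :- x₁ :* x))) refl)
    (vanishes sum ⊞ vanishes c≡1 ⊞ vanishes x₋≡1 ⊞ vanishes x≡x₁ ⊞ vanishes recˣ ⊞ vanishes formula)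

  1+by₊≡0 : c ≡ 1# → y₋ ≡ 1# → y ≡ y₁ → y₁ ≡ 0# → Recʸ → 1# + b * y₊ ≡ 0#
  1+by₊≡0 c≡1 y₋≡1 y≡y₁ y₁≡0 recʸ = by-combination
    (solve-window (λ c a b k x₁ y₁ e x₋ x x₊ y₋ y y₊ →
       con 1ℤ :+ b :* y₊ :- con 0ℤ
       := :- y₋ :* (c :- con 1ℤ)
          :+ con -1ℤ :* (y₋ :- con 1ℤ)
          :+ (k :* y₁ :- a) :* (y :- y₁)
          :+ (k :* y₁ :- a) :* (y₁ :- con 0ℤ)
          :+ con 1ℤ :* recurrenceₑ c a b (k :* y₁) y₋ y y₊) refl)
    (vanishes c≡1 ⊞ vanishes y₋≡1 ⊞ vanishes y≡y₁ ⊞ vanishes y₁≡0 ⊞ vanishes recʸ)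

  ay[x₊-1]≡0 : y₋ ≡ y₁ → y₁ ≡ 0# → x ≡ 1# → Recʸ → Recˣʸ → a * y * (x₊ - 1#) ≡ 0#
  ay[x₊-1]≡0 y₋≡y₁ y₁≡0 x≡1 recʸ recˣʸ = by-combination
    (solve-window (λ c a b k x₁ y₁ e x₋ x x₊ y₋ y y₊ →
       a :* y :* (x₊ :- con 1ℤ) :- con 0ℤ
       := (:- (x₊ :* c) :+ c :* x₋) :* (y₋ :- y₁)
          :+ (:- (x₊ :* (c :- k :* y)) :- (k :* x₁ :* (x :* y) :- c :* x₋)) :* (y₁ :- con 0ℤ)
          :+ a :* y :* (x :- con 1ℤ)
          :+ x₊ :* recurrenceₑ c a b (k :* y₁) y₋ y y₊
          :+ con -1ℤ :* recurrenceₑ c a b (k :* (x₁ :* y₁)) (x₋ :* y₋) (x :* y) (x₊ :* y₊)) refl)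
    (vanishes y₋≡y₁ ⊞ vanishes y₁≡0 ⊞ vanishes x≡1 ⊞ vanishes recʸ ⊞ vanishes recˣʸ)

record FeasibleArray (D : ℕ) (p : ℕ → ℕ → ℕ → ℕ) : Set where
  open Params D p
  open N using (_≤_; _<_)
  field
    3≤D     : 3 ≤ D
    a₀≡0    : a 0 ≡ 0
    c₁≡1    : c 1 ≡ 1
    c+a+b≡k : ∀ j → suc j < D → c (suc j) N.+ a (suc j) N.+ b (suc j) ≡ k
    c≢0     : ∀ j → suc j < D → c (suc j) ≢ 0
    b≢0     : ∀ j → suc j < D → b (suc j) ≢ 0
    a₁≢0    : a 1 ≢ 0
    a₂≢0    : a 2 ≢ 0

module Analysis (R : RealField) {D : ℕ} {p : ℕ → ℕ → ℕ → ℕ} (array : FeasibleArray D p) where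
  open RealField R hiding (_<_; _≤_)
  open N using (_≤_; _<_)
  open FieldProperties R
  open Equations R
  open Params D p
  open Cosine R D p
  open FeasibleArray array

  K : Carrier
  K = fromℕ k

  A B C : ℕ → Carrier
  A i = fromℕ (a i)
  B i = fromℕ (b i)
  C i = fromℕ (c i)

  1<D : 1 < D
  1<D = ℕ.<-≤-trans (s≤s (s≤s z≤n)) 3≤D

  2<D : 2 < D
  2<D = 3≤D

  K≡C+A+B : ∀ j → suc j < D → K ≡ C (suc j) + A (suc j) + B (suc j)
  K≡C+A+B j j+1<D = begin
    fromℕ k                                        ≡⟨ cong fromℕ (sym (c+a+b≡k j j+1<D)) ⟩
    fromℕ (c (suc j) N.+ a (suc j) N.+ b (suc j))  ≡⟨ fromℕ-+ (c (suc j) N.+ a (suc j)) _ ⟩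
    fromℕ (c (suc j) N.+ a (suc j)) + B (suc j)    ≡⟨ cong (_+ B (suc j)) (fromℕ-+ (c (suc j)) _) ⟩
    C (suc j) + A (suc j) + B (suc j)              ∎
    where open ≡-Reasoning

  C₁≡1 : C 1 ≡ 1#
  C₁≡1 = trans (cong fromℕ c₁≡1) (+-idʳ 1#)

  K≢0 : K ≢ 0#
  K≢0 = fromℕ-≢0 λ k≡0 → ℕ.1+n≢0 (begin
    1 N.+ a 1 N.+ b 1    ≡⟨ cong (λ c₁ → c₁ N.+ a 1 N.+ b 1) (sym c₁≡1) ⟩
    c 1 N.+ a 1 N.+ b 1  ≡⟨ c+a+b≡k 0 1<D ⟩
    k                    ≡⟨ k≡0 ⟩
    0                    ∎)
    where open ≡-Reasoning

  A+A≢0 : ∀ {i} → a i ≢ 0 → A i + A i ≢ 0#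
  A+A≢0 {i} aᵢ≢0 2Aᵢ≡0 = aᵢ≢0 (ℕ.m+n≡0⇒m≡0 (a i) (fromℕ≡0⇒≡0 (trans (fromℕ-+ (a i) (a i)) 2Aᵢ≡0)))

  A+B≢0 : ∀ j → suc j < D → A (suc j) + B (suc j) ≢ 0#
  A+B≢0 j j+1<D A+B≡0 = b≢0 j j+1<D
    (ℕ.m+n≡0⇒n≡0 (a (suc j)) (fromℕ≡0⇒≡0 (trans (fromℕ-+ (a (suc j)) (b (suc j))) A+B≡0)))

  2a₁[2a₂+c₂]+2a₂b₁≢0 : (A 1 + A 1) * (A 2 + A 2 + C 2) + (A 2 + A 2) * B 1 ≢ 0#
  2a₁[2a₂+c₂]+2a₂b₁≢0 sum≡0 =
    [ a₁≢0 ∘ ℕ.m+n≡0⇒m≡0 (a 1) , c≢0 1 2<D ∘ ℕ.m+n≡0⇒n≡0 (a 2 N.+ a 2) ]′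
    (ℕ.m*n≡0⇒m≡0∨n≡0 (a 1 N.+ a 1) (ℕ.m+n≡0⇒m≡0 _ (fromℕ≡0⇒≡0 (trans fromℕ-n sum≡0))))
    where
    n : ℕ
    n = (a 1 N.+ a 1) N.* (a 2 N.+ a 2 N.+ c 2) N.+ (a 2 N.+ a 2) N.* b 1
    fromℕ-n : fromℕ n ≡ (A 1 + A 1) * (A 2 + A 2 + C 2) + (A 2 + A 2) * B 1
    fromℕ-n = begin
      fromℕ n
        ≡⟨ fromℕ-+ ((a 1 N.+ a 1) N.* (a 2 N.+ a 2 N.+ c 2)) _ ⟩
      fromℕ ((a 1 N.+ a 1) N.* (a 2 N.+ a 2 N.+ c 2)) + fromℕ ((a 2 N.+ a 2) N.* b 1)
        ≡⟨ cong₂ _+_ (fromℕ-* (a 1 N.+ a 1) _) (fromℕ-* (a 2 N.+ a 2) (b 1)) ⟩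
      fromℕ (a 1 N.+ a 1) * fromℕ (a 2 N.+ a 2 N.+ c 2) + fromℕ (a 2 N.+ a 2) * B 1
        ≡⟨ cong₂ (λ u v → u * v + fromℕ (a 2 N.+ a 2) * B 1) (fromℕ-+ (a 1) (a 1))
                 (trans (fromℕ-+ (a 2 N.+ a 2) (c 2)) (cong (_+ C 2) (fromℕ-+ (a 2) (a 2)))) ⟩
      (A 1 + A 1) * (A 2 + A 2 + C 2) + fromℕ (a 2 N.+ a 2) * B 1
        ≡⟨ cong (λ u → (A 1 + A 1) * (A 2 + A 2 + C 2) + u * B 1) (fromℕ-+ (a 2) (a 2)) ⟩
      (A 1 + A 1) * (A 2 + A 2 + C 2) + (A 2 + A 2) * B 1
        ∎
      where open ≡-Reasoning

  module WindowOf (x y : ℕ → Carrier) (e : Carrier) (j : ℕ) =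
    Window R (C (suc j)) (A (suc j)) (B (suc j)) K (x 1) (y 1) e
             (x j) (x (suc j)) (x (suc (suc j))) (y j) (y (suc j)) (y (suc (suc j)))

  module PseudoCosine {f : ℕ → Carrier} (pcs : PCS f) where
    private
      θ : Carrier
      θ = proj₁ pcs

    f₀≡1 : f 0 ≡ 1#
    f₀≡1 = proj₁ (proj₂ pcs)

    θ≡K*f₁ : θ ≡ K * f 1
    θ≡K*f₁ = θ≡kx₁ (cong fromℕ a₀≡0) f₀≡1 (proj₂ (proj₂ pcs) 0 (ℕ.<-trans (s≤s z≤n) 1<D))

    recurrence : ∀ j → suc j < D →
                 Recurrence (C (suc j)) (A (suc j)) (B (suc j)) (K * f 1) (f j) (f (suc j))
                     (f (suc (suc j)))
    recurrence j j+1<D = trans (proj₂ (proj₂ pcs) (suc j) j+1<D) (cong (_* f (suc j)) θ≡K*f₁)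

    f₁≢1 : ¬ IsPCS f K → f 1 ≢ 1#
    f₁≢1 nontrivial f₁≡1 = nontrivial (subst (IsPCS f) θ≡K (proj₂ pcs))
      where θ≡K = trans θ≡K*f₁ (trans (cong (K *_) f₁≡1) (*-idʳ K))

    no-consecutive-zeros : ∀ m → suc m ≤ D → f m ≡ 0# → f (suc m) ≡ 0# → ⊥
    no-consecutive-zeros zero    _       f₀≡0 _      = 0≢1 (trans (sym f₀≡0) f₀≡1)
    no-consecutive-zeros (suc m) m+2≤D fₘ₊₁≡0 fₘ₊₂≡0 = no-consecutive-zeros m (ℕ.<⇒≤ m+2≤D)
      (x≢0⇒x*y≡0⇒y≡0 (fromℕ-≢0 (c≢0 m m+2≤D)) (recurrence-zeros fₘ₊₁≡0 fₘ₊₂≡0 (recurrence m m+2≤D)))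
      fₘ₊₁≡0

  Linking : (e : Carrier) (x y : ℕ → Carrier) → Set
  Linking e x y = ∀ j → suc j ≤ D → Linked e (x j) (x (suc j)) (y j) (y (suc j))

  module Pair {x y : ℕ → Carrier} {e : Carrier} (x-pcs : PCS x) (y-pcs : PCS y)
      (link : Linking e x y) where
    module X = PseudoCosine x-pcs
    module Y = PseudoCosine y-pcs
    module W = WindowOf x y e

    sum : ∀ j → suc j < D → W.Sum j
    sum = K≡C+A+B

    start : W.Start 0
    start = W.link⇒start 0 X.f₀≡1 Y.f₀≡1 refl refl (link 0 (ℕ.<⇒≤ 1<D))

    -- With e = - 1 the linking relations force x₁ = - 1, y₂ = y₁ and
    -- x₃ = - x₂, and then the recurrences give 2a₁(2a₂ + c₂) + 2a₂b₁ = 0.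
    e≢-1 : y 1 ≢ 1# → e ≢ - 1#
    e≢-1 y₁≢1 e≡-1 = 2a₁[2a₂+c₂]+2a₂b₁≢0
      ([a₁+a₁][a₂+a₂+c₂]+[a₂+a₂]b₁≡0 b₁[x₂-1]≡a₁+a₁ x₂[a₂+a₂+c₂]≡c₂)
      where
      x₁≡-1 : x 1 ≡ - 1#
      x₁≡-1 = x-y≡0⇒x≡y (x≢0⇒x*y≡0⇒y≡0 (x≢y⇒x-y≢0 y₁≢1) (W.e≡-1⇒[y₁-1][x₁+1]≡0 0 e≡-1 start))
      b₁[x₂-1]≡a₁+a₁ : B 1 * (x 2 - 1#) ≡ A 1 + A 1
      b₁[x₂-1]≡a₁+a₁ = W.b[x₊-1]≡a+a 0 (sum 0 1<D) C₁≡1 X.f₀≡1 refl x₁≡-1 (X.recurrence 0 1<D)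
      x₂≢1 : x 2 ≢ 1#
      x₂≢1 x₂≡1 = A+A≢0 a₁≢0 (a+a≡0 x₂≡1 b₁[x₂-1]≡a₁+a₁)
      y₂≡y₁ : y 2 ≡ y 1
      y₂≡y₁ = x-y≡0⇒x≡y
          (x≢0⇒x*y≡0⇒y≡0 (x≢y⇒x-y≢0 x₂≢1) (W.e≡-1⇒[x-1][y-y₋]≡0 1 e≡-1 x₁≡-1 (link 1 (ℕ.<⇒≤ 2<D))))
      Ky₁+1≡0 : K * y 1 + 1# ≡ 0#
      Ky₁+1≡0 = x≢0⇒x*y≡0⇒y≡0 (x≢y⇒x-y≢0 y₁≢1)
          (W.[y₁-1][ky₁+1]≡0 0 (sum 0 1<D) C₁≡1 Y.f₀≡1 refl y₂≡y₁ (Y.recurrence 0 1<D))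
      y₃≢y₂ : y 3 ≢ y 2
      y₃≢y₂ y₃≡y₂ = y₁≢1 (y₁≡1 (trans y₃≡y₂ y₂≡y₁)
        (W.b[y₊-y₁]≡1-y₁ 1 (sum 1 2<D) refl y₂≡y₁ Ky₁+1≡0 (Y.recurrence 1 2<D)))
      x₃≡-x₂ : x 3 ≡ - x 2
      x₃≡-x₂ = x-y≡0⇒x≡y
          (x≢0⇒x*y≡0⇒y≡0 (x≢y⇒x-y≢0 y₃≢y₂) (W.e≡-1⇒[y₊-y][x₊+x]≡0 1 e≡-1 (link 2 3≤D)))
      x₂[a₂+a₂+c₂]≡c₂ : x 2 * (A 2 + A 2 + C 2) ≡ C 2
      x₂[a₂+a₂+c₂]≡c₂ = W.x[a+a+c]≡c 1 (sum 1 2<D) x₁≡-1 x₁≡-1 x₃≡-x₂ (X.recurrence 1 2<D)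

  module TightPair {σ ρ : ℕ → Carrier} {ε : Carrier}
    (σ-nontrivial : NontrivialPCS σ) (ρ-nontrivial : NontrivialPCS ρ)
    (σρ-pcs : PCS (λ i → σ i * ρ i)) (link : Linking ε σ ρ) where

    open Pair (proj₁ σ-nontrivial) (proj₁ ρ-nontrivial) link public
    module Σ = PseudoCosine (proj₁ σ-nontrivial)
    module Ρ = PseudoCosine (proj₁ ρ-nontrivial)
    module ΣΡ = PseudoCosine σρ-pcs

    recˣʸ : ∀ j → suc j < D → W.Recˣʸ j
    recˣʸ = ΣΡ.recurrence

    σ₁≢1 : σ 1 ≢ 1#
    σ₁≢1 = Σ.f₁≢1 (proj₂ σ-nontrivial)

    ρ₁≢1 : ρ 1 ≢ 1#
    ρ₁≢1 = Ρ.f₁≢1 (proj₂ ρ-nontrivial)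

    ε≢-1 : ε ≢ - 1#
    ε≢-1 = e≢-1 ρ₁≢1

    -- Exchanging σ and ρ replaces ε by - ε.
    ε≢1 : ε ≢ 1#
    ε≢1 ε≡1 = Pair.e≢-1 (proj₁ ρ-nontrivial) (proj₁ σ-nontrivial)
      (λ j j+1≤D → Linked-swap (link j j+1≤D)) σ₁≢1 (cong (λ t → - t) ε≡1)

    σ₁≢ε : σ 1 ≢ ε
    σ₁≢ε σ₁≡ε = ε≢-1 (trans (sym σ₁≡ε) σ₁≡-1)
      where
      σ₁≡-1 : σ 1 ≡ - 1#
      σ₁≡-1 = x-y≡0⇒x≡y (x≢0⇒x*y≡0⇒y≡0 (x≢y⇒x-y≢0 σ₁≢1) (W.e≡x₁⇒[x₁-1][x₁+1]≡0 0 (sym σ₁≡ε) start))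

    σᵢ≢σᵢ₊₁ : ∀ j → suc j ≤ D → σ j ≢ σ (suc j)
    σᵢ≢σᵢ₊₁ zero    _     σ₀≡σ₁ = σ₁≢1 (trans (sym σ₀≡σ₁) Σ.f₀≡1)
    σᵢ≢σᵢ₊₁ (suc j) j+2≤D σ₁≡σ₂ with σ (suc j) ≟ 0#
    ... | yes s≡0 = Σ.no-consecutive-zeros j (ℕ.<⇒≤ j+2≤D) σⱼ≡0 s≡0
      where
      σⱼ≡0 : σ j ≡ 0#
      σⱼ≡0 = x≢0⇒x*y≡0⇒y≡0 (fromℕ-≢0 (c≢0 j j+2≤D))
        (recurrence-zeros s≡0 (trans (sym σ₁≡σ₂) s≡0) (Σ.recurrence j j+2≤D))
    ... | no s≢0 = Ρ.no-consecutive-zeros j (ℕ.<⇒≤ j+2≤D) ρⱼ≡0 ρⱼ₊₁≡0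
      where
      ρⱼ≡ρ₁ρⱼ₊₁ : ρ j ≡ ρ 1 * ρ (suc j)
      ρⱼ≡ρ₁ρⱼ₊₁ = x-y≡0⇒x≡y (x≢0⇒x*y≡0⇒y≡0 s≢0 (x≢0⇒x*y≡0⇒y≡0
        (x≢0∧y≢0⇒x*y≢0 K≢0 (x≢y⇒x-y≢0 σ₁≢1))
        (W.k[x₁-1]x[y₋-y₁y]≡0 j (sum j j+2≤D) (sym σ₁≡σ₂)
          (Σ.recurrence j j+2≤D) (Ρ.recurrence j j+2≤D) (recˣʸ j j+2≤D))))
      ρⱼ₊₂≡ρⱼ₊₁ : ρ (suc (suc j)) ≡ ρ (suc j)
      ρⱼ₊₂≡ρⱼ₊₁ = x-y≡0⇒x≡y (x≢0⇒x*y≡0⇒y≡0 s≢0 (x≢0⇒x*y≡0⇒y≡0 (x≢y⇒x-y≢0 (ε≢1 ∘ sym))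
        (W.[1-e]x[y₊-y]≡0 j (sym σ₁≡σ₂) (link (suc j) j+2≤D))))
      ρⱼ₊₁≡0 : ρ (suc j) ≡ 0#
      ρⱼ₊₁≡0 = x≢0⇒x*y≡0⇒y≡0 (A+B≢0 j j+2≤D) (x≢0⇒x*y≡0⇒y≡0 (x≢y⇒x-y≢0 ρ₁≢1)
        (W.[y₁-1][a+b]y≡0 j (sum j j+2≤D) ρⱼ≡ρ₁ρⱼ₊₁ ρⱼ₊₂≡ρⱼ₊₁ (Ρ.recurrence j j+2≤D)))
      ρⱼ≡0 : ρ j ≡ 0#
      ρⱼ≡0 = trans ρⱼ≡ρ₁ρⱼ₊₁ (trans (cong (ρ 1 *_) ρⱼ₊₁≡0) (zeroʳ (ρ 1)))

    formula-when-ρⱼ₊₁≡0 : ∀ j → suc j < D → ρ (suc j) ≡ 0# → W.Formula j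
    formula-when-ρⱼ₊₁≡0 j j+1<D r≡0 =
      W.formula-when-x₊≡x₋≡ex j x₊≡x₋ x₋≡εx (sum j j+1<D) (Σ.recurrence j j+1<D)
      where
      r₋≢0 : ρ j ≢ 0#
      r₋≢0 r₋≡0 = Ρ.no-consecutive-zeros j (ℕ.<⇒≤ j+1<D) r₋≡0 r≡0
      x₊≡x₋ : σ (suc (suc j)) ≡ σ j
      x₊≡x₋ = x-y≡0⇒x≡y (x≢0⇒x*y≡0⇒y≡0 (x≢0∧y≢0⇒x*y≢0 (fromℕ-≢0 (c≢0 j j+1<D)) r₋≢0)
        (W.cy₋[x₊-x₋]≡0 j r≡0 (Ρ.recurrence j j+1<D) (recˣʸ j j+1<D)))
      x₋≡εx : σ j ≡ ε * σ (suc j)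
      x₋≡εx = x-y≡0⇒x≡y (x≢0⇒x*y≡0⇒y≡0 r₋≢0 (W.y₋[x₋-ex]≡0 j r≡0 (link j (ℕ.<⇒≤ j+1<D))))

    formula-when-ρⱼ₊₁≢0 : ∀ j → suc j < D → ρ (suc j) ≢ 0# → W.Formula j
    formula-when-ρⱼ₊₁≢0 j j+1<D r≢0 = by-cases (σ (suc (suc j)) ≟ σ j)
      where
      [1-ε][ε+1]≢0 : (1# - ε) * (ε - - 1#) ≢ 0#
      [1-ε][ε+1]≢0 = x≢0∧y≢0⇒x*y≢0 (x≢y⇒x-y≢0 (ε≢1 ∘ sym)) (x≢y⇒x-y≢0 ε≢-1)
      σⱼ₊₁≡0-from : ρ (suc j) * σ (suc j) * ((1# - ε) * (ε - - 1#)) ≡ 0# → σ (suc j) ≡ 0#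
      σⱼ₊₁≡0-from = x≢0⇒x*y≡0⇒y≡0 r≢0 ∘ y≢0⇒x*y≡0⇒x≡0 [1-ε][ε+1]≢0
      δ₋≢0 : W.δ₋ j ≢ 0#
      δ₋≢0 δ₋≡0 = σᵢ≢σᵢ₊₁ j (ℕ.<⇒≤ j+1<D)
          (trans x₋≡εx (trans (cong (ε *_) σⱼ₊₁≡0) (trans (zeroʳ ε) (sym σⱼ₊₁≡0))))
        where
        x₋≡εx : σ j ≡ ε * σ (suc j)
        x₋≡εx = x-y≡0⇒x≡y δ₋≡0
        σⱼ₊₁≡0 : σ (suc j) ≡ 0#
        σⱼ₊₁≡0 = σⱼ₊₁≡0-from (W.yx[1-e][e+1]≡0 j x₋≡εx (link j (ℕ.<⇒≤ j+1<D)))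
      δ₊≢0 : W.δ₊ j ≢ 0#
      δ₊≢0 δ₊≡0 = σᵢ≢σᵢ₊₁ (suc j) j+1<D
          (trans σⱼ₊₁≡0 (sym (trans x₊≡εx (trans (cong (ε *_) σⱼ₊₁≡0) (zeroʳ ε)))))
        where
        x₊≡εx : σ (suc (suc j)) ≡ ε * σ (suc j)
        x₊≡εx = x-y≡0⇒x≡y δ₊≡0
        σⱼ₊₁≡0 : σ (suc j) ≡ 0#
        σⱼ₊₁≡0 = σⱼ₊₁≡0-from (W.yx[1-e][e+1]≡0₊ j x₊≡εx (link (suc j) j+1<D))
      δ₋δ₊≢0 : W.δ₋ j * W.δ₊ j ≢ 0#
      δ₋δ₊≢0 = x≢0∧y≢0⇒x*y≢0 δ₋≢0 δ₊≢0
      ρ[ε+1]≢0 : ρ (suc j) * (ε - - 1#) ≢ 0#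
      ρ[ε+1]≢0 = x≢0∧y≢0⇒x*y≢0 r≢0 (x≢y⇒x-y≢0 ε≢-1)
      F₂≡0 : W.F₂ j ≡ 0#
      F₂≡0 = x≢0⇒x*y≡0⇒y≡0 ρ[ε+1]≢0 (W.y[e+1]F₂≡0 j (sum j j+1<D) (Ρ.recurrence j j+1<D)
        (link j (ℕ.<⇒≤ j+1<D)) (link (suc j) j+1<D) start)
      F₄≡0 : W.F₄ j ≡ 0#
      F₄≡0 = x≢0⇒x*y≡0⇒y≡0 ρ[ε+1]≢0 (W.y[e+1]F₄≡0 j (sum j j+1<D) (Σ.recurrence j j+1<D)
        (Ρ.recurrence j j+1<D) (recˣʸ j j+1<D) (link j (ℕ.<⇒≤ j+1<D)) (link (suc j) j+1<D) start)
      x₋≡σ₁x : σ (suc (suc j)) ≡ σ j → σ j ≡ σ 1 * σ (suc j)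
      x₋≡σ₁x x₊≡x₋ = x-y≡0⇒x≡y (x≢0⇒x*y≡0⇒y≡0
        (x≢0∧y≢0⇒x*y≢0 (x≢0∧y≢0⇒x*y≢0 K≢0 (x≢y⇒x-y≢0 (σ₁≢1 ∘ sym))) δ₋δ₊≢0)
        (W.k[1-x₁]δ₋δ₊[x₋-x₁x]≡0 j x₊≡x₋ F₂≡0 F₄≡0))
      by-cases : Dec (σ (suc (suc j)) ≡ σ j) → W.Formula j
      by-cases (no x₊≢x₋)  = *-cancelʳ (x≢0∧y≢0⇒x*y≢0 δ₋δ₊≢0 (x≢y⇒x-y≢0 x₊≢x₋))
                                       (W.formula×δ₋δ₊[x₊-x₋] j (sum j j+1<D) F₂≡0 F₄≡0)
      by-cases (yes x₊≡x₋) = W.formula-when-x₊≡x₋≡x₁x j x₊≡x₋ (x₋≡σ₁x x₊≡x₋) (sum j j+1<D)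
          (Σ.recurrence j j+1<D)

    formula : ∀ j → suc j < D → W.Formula j
    formula j j+1<D with ρ (suc j) ≟ 0#
    ... | yes r≡0 = formula-when-ρⱼ₊₁≡0 j j+1<D r≡0
    ... | no  r≢0 = formula-when-ρⱼ₊₁≢0 j j+1<D r≢0

    Δ : Carrier
    Δ = (σ 1 * σ 1 - σ 2) * (1# - ε * σ 1)

    KΔ≡[σ₁-ε][σ₂-1] : K * Δ ≡ (σ 1 - ε) * (σ 2 - 1#)
    KΔ≡[σ₁-ε][σ₂-1] = *-cancelˡ (x≢y⇒x-y≢0 (σ₁≢1 ∘ sym))
      (W.formula-at-1 0 (sum 0 1<D) C₁≡1 Σ.f₀≡1 refl (Σ.recurrence 0 1<D) (formula 0 1<D))

    Δ≢0 : Δ ≢ 0#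
    Δ≢0 Δ≡0 = [ σ₁²-σ₂≢0 , 1-εσ₁≢0 ]′ (x*y≡0⇒x≡0⊎y≡0 Δ≡0)
      where
      σ₂≡1 : σ 2 ≡ 1#
      σ₂≡1 = x-y≡0⇒x≡y (x≢0⇒x*y≡0⇒y≡0 (x≢y⇒x-y≢0 σ₁≢ε)
        (trans (sym KΔ≡[σ₁-ε][σ₂-1]) (trans (cong (K *_) Δ≡0) (zeroʳ K))))

      σ₁²-σ₂≢0 : σ 1 * σ 1 - σ 2 ≢ 0#
      σ₁²-σ₂≢0 σ₁²-σ₂≡0 = A+A≢0 a₁≢0 (a+a≡0 σ₂≡1
        (W.b[x₊-1]≡a+a 0 (sum 0 1<D) C₁≡1 Σ.f₀≡1 refl σ₁≡-1 (Σ.recurrence 0 1<D)))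
        where
        σ₁≡-1 : σ 1 ≡ - 1#
        σ₁≡-1 = x-y≡0⇒x≡y (x≢0⇒x*y≡0⇒y≡0 (x≢y⇒x-y≢0 σ₁≢1) ([x-1][x+1]≡0 σ₂≡1 σ₁²-σ₂≡0))

      1-εσ₁≢0 : 1# - ε * σ 1 ≢ 0#
      1-εσ₁≢0 1-εσ₁≡0 = σᵢ≢σᵢ₊₁ 2 3≤D (trans σ₂≡1 (sym σ₃≡1))
        where
        ρ₁≡0 : ρ 1 ≡ 0#
        ρ₁≡0 = y≢0⇒x*y≡0⇒x≡0 (x≢y⇒x-y≢0 σ₁≢ε) (trans (W.start⇒y₁[x₁-e]≡1-ex₁ 0 start) 1-εσ₁≡0)
        1+b₁ρ₂≡0 : 1# + B 1 * ρ 2 ≡ 0#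
        1+b₁ρ₂≡0 = W.1+by₊≡0 0 C₁≡1 Ρ.f₀≡1 refl ρ₁≡0 (Ρ.recurrence 0 1<D)
        ρ₂≢0 : ρ 2 ≢ 0#
        ρ₂≢0 ρ₂≡0 = 0≢1 (begin
          0#              ≡⟨ sym 1+b₁ρ₂≡0 ⟩
          1# + B 1 * ρ 2  ≡⟨ cong (λ t → 1# + B 1 * t) ρ₂≡0 ⟩
          1# + B 1 * 0#   ≡⟨ cong (1# +_) (zeroʳ (B 1)) ⟩
          1# + 0#         ≡⟨ +-idʳ 1# ⟩
          1#              ∎)
          where open ≡-Reasoning
        σ₃≡1 : σ 3 ≡ 1#
        σ₃≡1 = x-y≡0⇒x≡y (x≢0⇒x*y≡0⇒y≡0 (x≢0∧y≢0⇒x*y≢0 (fromℕ-≢0 a₂≢0) ρ₂≢0)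
          (W.ay[x₊-1]≡0 1 refl ρ₁≡0 σ₂≡1 (Ρ.recurrence 1 2<D) (recˣʸ 1 2<D)))

    differences≢0 : ∀ j → suc j < D → (σ (suc (suc j)) - σ (suc j)) * (σ j - σ (suc j)) ≢ 0#
    differences≢0 j j+1<D = x≢0∧y≢0⇒x*y≢0 (x≢y⇒x-y≢0 (σᵢ≢σᵢ₊₁ (suc j) j+1<D ∘ sym))
                                        (x≢y⇒x-y≢0 (σᵢ≢σᵢ₊₁ j (ℕ.<⇒≤ j+1<D)))

    a-formula : ∀ j → suc j < D →
      A (suc j) ≡ (ε - 1#) * (1# - σ 2) * Δ ⁻¹
                  * ((σ (suc (suc j)) - σ 1 * σ (suc j)) * (σ j - σ 1 * σ (suc j))
                     * ((σ (suc (suc j)) - σ (suc j)) * (σ j - σ (suc j))) ⁻¹)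
    a-formula j j+1<D = a*y*d≡n*x⇒a≡n/d*x/y (differences≢0 j j+1<D) Δ≢0
      (*-cancelˡ (x≢y⇒x-y≢0 σ₁≢ε) (eliminate-k (formula j j+1<D) KΔ≡[σ₁-ε][σ₂-1]))

module Distance {n : ℕ} (Γ : Graph n) where
  open Graph Γ
  open N using (_+_; _≤_; _<_)
  open Equivalence

  -- Records rather than T (…) itself, so that their indices can be inferred.
  record Adj (x y : Fin n) : Set where
    constructor adjacent
    field isAdjacent : T (adj x y)

  record Reach (k : ℕ) (x y : Fin n) : Set where
    constructor reached
    field isReached : T (reach Γ k x y)

  record Dist (x y : Fin n) (d : ℕ) : Set where
    constructor at-distance
    field isAtDistance : T (isDist Γ x y d)

  Adj-sym : ∀ {x y} → Adj x y → Adj y x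
  Adj-sym {x} {y} (adjacent a) = adjacent (subst T (adj-sym x y) a)

  Adj-irrefl : ∀ {x} → ¬ Adj x x
  Adj-irrefl {x} (adjacent a) = subst T (adj-irref x) a

  Reach-refl : ∀ {x} → Reach 0 x x
  Reach-refl = reached (fromWitness refl)

  Reach-zero⇒≡ : ∀ {x y} → Reach 0 x y → x ≡ y
  Reach-zero⇒≡ (reached r) = toWitness r

  Reach-suc : ∀ {k x y} → Reach k x y → Reach (suc k) x y
  Reach-suc (reached r) = reached (from T-∨ (inj₁ r))

  Reach-step : ∀ {k x y z} → Reach k x y → Adj y z → Reach (suc k) x z
  Reach-step {k} {x} {y} {z} (reached r) (adjacent a) = reached
    (from T-∨ (inj₂ (any⁺ (λ w → reach Γ k x w ∧ adj w z) (lose (∈-allFin y) (from T-∧ (r , a))))))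

  Reach-suc⁻ : ∀ {k x z} → Reach (suc k) x z → Reach k x z ⊎ ∃[ y ] Reach k x y × Adj y z
  Reach-suc⁻ {k} {x} {z} (reached r) with to T-∨ r
  ... | inj₁ r′ = inj₁ (reached r′)
  ... | inj₂ r′ with satisfied (any⁻ (λ w → reach Γ k x w ∧ adj w z) (allFin n) r′)
  ...   | y , ra = inj₂ (y , reached (proj₁ (to T-∧ ra)) , adjacent (proj₂ (to T-∧ ra)))

  Reach-mono : ∀ {k l x y} → k ≤ l → Reach k x y → Reach l x y
  Reach-mono k≤l = go (ℕ.≤⇒≤′ k≤l)
    where
    go : ∀ {k l x y} → k ≤′ l → Reach k x y → Reach l x y
    go ≤′-refl        r = r
    go (≤′-step k≤′l) r = Reach-suc (go k≤′l r)

  Reach-stepˡ : ∀ {k x y z} → Adj x y → Reach k y z → Reach (suc k) x z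
  Reach-stepˡ {zero} a r with Reach-zero⇒≡ r
  ... | refl = Reach-step Reach-refl a
  Reach-stepˡ {suc k} a r with Reach-suc⁻ r
  ... | inj₁ r′           = Reach-suc (Reach-stepˡ a r′)
  ... | inj₂ (w , r′ , a′) = Reach-step (Reach-stepˡ a r′) a′

  Reach-sym : ∀ {k x y} → Reach k x y → Reach k y x
  Reach-sym {zero} r with Reach-zero⇒≡ r
  ... | refl = Reach-refl
  Reach-sym {suc k} r with Reach-suc⁻ r
  ... | inj₁ r′           = Reach-suc (Reach-sym r′)
  ... | inj₂ (w , r′ , a) = Reach-stepˡ (Adj-sym a) (Reach-sym r′)

  Reach-trans : ∀ {k l x y z} → Reach k x y → Reach l y z → Reach (k + l) x z
  Reach-trans {k} {zero} r r′ with Reach-zero⇒≡ r′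
  ... | refl = subst (λ m → Reach m _ _) (sym (ℕ.+-identityʳ k)) r
  Reach-trans {k} {suc l} {x} {y} {z} r r′ =
    subst (λ m → Reach m x z) (sym (ℕ.+-suc k l)) (step (Reach-suc⁻ r′))
    where
    step : Reach l y z ⊎ ∃[ w ] Reach l y w × Adj w z → Reach (suc (k + l)) x z
    step (inj₁ r″)          = Reach-suc (Reach-trans r r″)
    step (inj₂ (w , r″ , a)) = Reach-step (Reach-trans r r″) a

  Dist⇒Reach : ∀ {x y d} → Dist x y d → Reach d x y
  Dist⇒Reach {d = zero}  (at-distance r) = reached r
  Dist⇒Reach {d = suc d} (at-distance r) = reached (proj₁ (to T-∧ r))

  Dist-minimal : ∀ {x y d m} → Dist x y d → Reach m x y → d ≤ m
  Dist-minimal {d = zero}              _               _ = z≤n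
  Dist-minimal {x} {y} {d = suc d} {m} (at-distance r) r′ with suc d N.≤? m
  ... | yes d<m = d<m
  ... | no  d≮m = ⊥-elim (not-reached (Reach.isReached (Reach-mono (ℕ.≤-pred (ℕ.≰⇒> d≮m)) r′)))
    where
    not-reached : ¬ T (reach Γ d x y)
    not-reached with reach Γ d x y | proj₂ (to (T-∧ {reach Γ (suc d) x y}) r)
    ... | true  | ()
    ... | false | _  = λ ()

  Reach∧minimal⇒Dist : ∀ {x y d} → Reach d x y → (∀ {m} → Reach m x y → d ≤ m) → Dist x y d
  Reach∧minimal⇒Dist {d = zero}          (reached r) _       = at-distance r
  Reach∧minimal⇒Dist {x} {y} {d = suc d} (reached r) minimal = at-distance
      (from T-∧ (r , not-reached))
    where
    not-reached : T (not (reach Γ d x y))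
    not-reached with reach Γ d x y in eq
    ... | true  = ⊥-elim (ℕ.1+n≰n (minimal (reached (subst T (sym eq) _))))
    ... | false = _

  Dist-unique : ∀ {x y d d′} → Dist x y d → Dist x y d′ → d ≡ d′
  Dist-unique h h′ = ℕ.≤-antisym (Dist-minimal h (Dist⇒Reach h′)) (Dist-minimal h′ (Dist⇒Reach h))

  Dist-sym : ∀ {x y d} → Dist x y d → Dist y x d
  Dist-sym h = Reach∧minimal⇒Dist (Reach-sym (Dist⇒Reach h)) (Dist-minimal h ∘ Reach-sym)

  Dist-refl : ∀ {x} → Dist x x 0
  Dist-refl = at-distance (Reach.isReached Reach-refl)

  Adj⇒Dist₁ : ∀ {x y} → Adj x y → Dist x y 1
  Adj⇒Dist₁ {x} {y} a = Reach∧minimal⇒Dist (Reach-step Reach-refl a) minimal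
    where
    minimal : ∀ {m} → Reach m x y → 1 ≤ m
    minimal {zero} r with Reach-zero⇒≡ r
    ... | refl = ⊥-elim (Adj-irrefl a)
    minimal {suc m} r = s≤s z≤n

  Dist-pred : ∀ {x z d} → Dist x z (suc d) → ∃[ y ] Dist x y d × Adj y z
  Dist-pred {x} {z} {d} h with Reach-suc⁻ (Dist⇒Reach h)
  ... | inj₁ r           = ⊥-elim (ℕ.1+n≰n (Dist-minimal h r))
  ... | inj₂ (y , r , a) = y , Reach∧minimal⇒Dist r
      (λ r′ → ℕ.≤-pred (Dist-minimal h (Reach-step r′ a))) , a

  Dist₁⇒Adj : ∀ {x y} → Dist x y 1 → Adj x y
  Dist₁⇒Adj h with Dist-pred h
  ... | y , h₀ , a with Reach-zero⇒≡ (Dist⇒Reach h₀)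
  ...   | refl = a

  Dist-down : ∀ {x y d e} → Dist x y e → d ≤ e → ∃[ z ] Dist x z d
  Dist-down {y = y} h d≤e with ℕ.≤⇒≤′ d≤e
  ... | ≤′-refl        = y , h
  ... | ≤′-step d≤′e′  with Dist-pred h
  ...   | z , h′ , _  = Dist-down h′ (ℕ.≤′⇒≤ d≤′e′)

  isDist≡true⇒Dist : ∀ {x y d} → isDist Γ x y d ≡ true → Dist x y d
  isDist≡true⇒Dist = at-distance ∘ from T-≡

  Dist⇒isDist≡true : ∀ {x y d} → Dist x y d → isDist Γ x y d ≡ true
  Dist⇒isDist≡true (at-distance h) = to T-≡ h

  neighbour-distance : Connected Γ → ∀ {x y z d} → Dist x y d → Adj y z →
                       ∃[ d′ ] Dist x z d′ × d′ ≤ suc d × d ≤ suc d′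
  neighbour-distance connected {x} {y} {z} h a with connected x z
  ... | d′ , h′ = d′ , isDist≡true⇒Dist h′
                     , Dist-minimal (isDist≡true⇒Dist h′) (Reach-step (Dist⇒Reach h) a)
                     , Dist-minimal h (Reach-step (Dist⇒Reach (isDist≡true⇒Dist h′)) (Adj-sym a))

  count-≢0 : ∀ {x y i j z} → Dist x z i → Dist y z j → count Γ x y i j ≢ 0
  count-≢0 {z = z} (at-distance h) (at-distance h′) count≡0 =
    ℕ.<⇒≢ (filter-some _ (lose (∈-allFin z) (from T-∧ (h , h′)))) (sym count≡0)

  count-≡0 : ∀ {x y i j} → (∀ {z} → Dist x z i → ¬ Dist y z j) → count Γ x y i j ≡ 0
  count-≡0 {x} {y} {i} {j} disjoint = cong length (filter-none _ (All.tabulate none))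
    where
    none : ∀ {z} → z ∈ allFin n → ¬ T (isDist Γ x z i ∧ isDist Γ y z j)
    none _ h = disjoint (at-distance (proj₁ (to T-∧ h))) (at-distance (proj₂ (to T-∧ h)))

  count-≡1 : ∀ {x y i j z} → Dist x z i → Dist y z j → (∀ {w} → Dist x w i → Dist y w j → w ≡ z) →
             count Γ x y i j ≡ 1
  count-≡1 {x} {y} {i} {j} {z} (at-distance h) (at-distance h′) unique =
    unique-constant (Unique.filter⁺ (T? ∘ counted) (Unique.allFin⁺ n))
                    (All.tabulate (λ w∈ →
                        uncurry′ unique′
                        (to T-∧ (proj₂ (∈-filter⁻ (T? ∘ counted) {xs = allFin n} w∈)))))
                    (∈-filter⁺ (T? ∘ counted) (∈-allFin z) (from T-∧ (h , h′)))
    where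
    counted : Fin n → Bool
    counted w = isDist Γ x w i ∧ isDist Γ y w j
    unique′ : ∀ {w} → T (isDist Γ x w i) → T (isDist Γ y w j) → w ≡ z
    unique′ hw hw′ = unique (at-distance hw) (at-distance hw′)
    unique-constant : ∀ {ws : List (Fin n)} → Unique ws → All (_≡ z) ws → z ∈ ws → length ws ≡ 1
    unique-constant (_ ∷ [])                         _                    _ = refl
    unique-constant ((w≢w′ All.∷ _) ∷ _) (w≡z All.∷ w′≡z All.∷ _) _ = ⊥-elim
        (w≢w′ (trans w≡z (sym w′≡z)))

  count-≢0⁻ : ∀ {x y i j} → count Γ x y i j ≢ 0 → ∃[ z ] Dist x z i × Dist y z j
  count-≢0⁻ {x} {y} {i} {j} count≢0 with filterᵇ (λ w → isDist Γ x w i ∧ isDist Γ y w j) (allFin n)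
      in eq
  ... | []    = ⊥-elim (count≢0 refl)
  ... | z ∷ _ = z , at-distance (proj₁ counted) , at-distance (proj₂ counted)
    where
    counted : T (isDist Γ x z i) × T (isDist Γ y z j)
    counted = to T-∧ (proj₂ (∈-filter⁻ (T? ∘ λ w → isDist Γ x w i ∧ isDist Γ y w j)
                                         {xs = allFin n} (subst (z ∈_) (sym eq) (here refl))))

  private
    regroup : ∀ a b c d e f → (a + b + c) + (d + e + f) ≡ (a + d) + (b + e) + (c + f)
    regroup = solve-∀

    indicator : Bool → ℕ
    indicator true  = 1
    indicator false = 0

    length-filterᵇ-∷ : ∀ (f : Fin n → Bool) z zs →
                       length (filterᵇ f (z ∷ zs)) ≡ indicator (f z) + length (filterᵇ f zs)
    length-filterᵇ-∷ f z zs with f z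
    ... | true  = refl
    ... | false = refl

    length-filterᵇ-split : ∀ (f g₁ g₂ g₃ : Fin n → Bool) →
      (∀ z → indicator (f z) ≡ indicator (g₁ z) + indicator (g₂ z) + indicator (g₃ z)) → ∀ zs →
      length (filterᵇ f zs)
          ≡ length (filterᵇ g₁ zs) + length (filterᵇ g₂ zs) + length (filterᵇ g₃ zs)
    length-filterᵇ-split f g₁ g₂ g₃ split []       = refl
    length-filterᵇ-split f g₁ g₂ g₃ split (z ∷ zs) = begin
      length (filterᵇ f (z ∷ zs))
        ≡⟨ length-filterᵇ-∷ f z zs ⟩
      indicator (f z) + length (filterᵇ f zs)
        ≡⟨ cong₂ _+_ (split z) (length-filterᵇ-split f g₁ g₂ g₃ split zs) ⟩
      (indicator (g₁ z) + indicator (g₂ z) + indicator (g₃ z))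
        + (length (filterᵇ g₁ zs) + length (filterᵇ g₂ zs) + length (filterᵇ g₃ zs))
        ≡⟨ regroup (indicator (g₁ z)) (indicator (g₂ z)) (indicator (g₃ z)) _ _ _ ⟩
      (indicator (g₁ z) + length (filterᵇ g₁ zs)) + (indicator (g₂ z) + length (filterᵇ g₂ zs))
        + (indicator (g₃ z) + length (filterᵇ g₃ zs))
        ≡⟨ sym (cong₂ _+_ (cong₂ _+_ (length-filterᵇ-∷ g₁ z zs) (length-filterᵇ-∷ g₂ z zs))
                          (length-filterᵇ-∷ g₃ z zs)) ⟩
      length (filterᵇ g₁ (z ∷ zs)) + length (filterᵇ g₂ (z ∷ zs)) + length (filterᵇ g₃ (z ∷ zs)) ∎
      where open ≡-Reasoning

  isDist-false : ∀ {y z d j} → Dist y z d → j ≢ d → isDist Γ y z j ≡ false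
  isDist-false {y} {z} {d} {j} h j≢d with isDist Γ y z j in eq
  ... | true  = ⊥-elim (j≢d (Dist-unique (isDist≡true⇒Dist eq) h))
  ... | false = refl

  count-split : Connected Γ → ∀ {x y i} → Dist x y (suc i) →
                count Γ x x 1 1 ≡ count Γ x y 1 i + count Γ x y 1 (suc i)
                    + count Γ x y 1 (suc (suc i))
  count-split connected {x} {y} {i} h = length-filterᵇ-split _ _ _ _ pointwise (allFin n)
    where
    between : ∀ {d} → i ≤ d → d ≤ suc (suc i) → d ≡ i ⊎ d ≡ suc i ⊎ d ≡ suc (suc i)
    between i≤d d≤i+2 with ℕ.m≤n⇒m<n∨m≡n i≤d
    ... | inj₂ refl = inj₁ refl
    ... | inj₁ i<d with ℕ.m≤n⇒m<n∨m≡n i<d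
    ...   | inj₂ refl = inj₂ (inj₁ refl)
    ...   | inj₁ i+1<d = inj₂ (inj₂ (ℕ.≤-antisym d≤i+2 i+1<d))
    pointwise : ∀ z → indicator (isDist Γ x z 1 ∧ isDist Γ x z 1)
                    ≡ indicator (isDist Γ x z 1 ∧ isDist Γ y z i)
                      + indicator (isDist Γ x z 1 ∧ isDist Γ y z (suc i))
                      + indicator (isDist Γ x z 1 ∧ isDist Γ y z (suc (suc i)))
    pointwise z with isDist Γ x z 1 in eq
    ... | false = refl
    ... | true with neighbour-distance connected (Dist-sym h) (Dist₁⇒Adj (isDist≡true⇒Dist eq))
    ...   | d , h′ , d≤i+2 , i+1≤d+1 with between (ℕ.≤-pred i+1≤d+1) d≤i+2
    ...     | inj₁ refl
      rewrite Dist⇒isDist≡true h′ | isDist-false h′ (ℕ.>⇒≢ (ℕ.n<1+n i))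
            | isDist-false h′ (ℕ.>⇒≢ (ℕ.m<n⇒m<1+n (ℕ.n<1+n i))) = refl
    ...     | inj₂ (inj₁ refl)
      rewrite Dist⇒isDist≡true h′ | isDist-false h′ (ℕ.<⇒≢ (ℕ.n<1+n i))
            | isDist-false h′ (ℕ.>⇒≢ (ℕ.n<1+n (suc i))) = refl
    ...     | inj₂ (inj₂ refl)
      rewrite Dist⇒isDist≡true h′ | isDist-false h′ (ℕ.<⇒≢ (ℕ.m<n⇒m<1+n (ℕ.n<1+n i)))
            | isDist-false h′ (ℕ.<⇒≢ (ℕ.n<1+n (suc i))) = refl

module IntersectionArray {n : ℕ} (Γ : Graph n) {D : ℕ} {p : ℕ → ℕ → ℕ → ℕ}
  (connected : Connected Γ) (diameter : HasDiameter Γ D) (numbers : IntersectionNumbers Γ D p)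
  (3≤D : 3 N.≤ D) (a₁≢0 : Params.a D p 1 ≢ 0) where
  open Distance Γ
  open Params D p
  open N using (_≤_; _<_)

  private
    1≤D : 1 ≤ D
    1≤D = ℕ.≤-trans (s≤s z≤n) 3≤D

    2≤D : 2 ≤ D
    2≤D = ℕ.≤-trans (s≤s (s≤s z≤n)) 3≤D

    x₀ : Fin n
    x₀ = proj₁ (proj₂ diameter)

    vertex-at : ∀ {d} → d ≤ D → ∃[ y ] Dist x₀ y d
    vertex-at = Dist-down (isDist≡true⇒Dist (proj₂ (proj₂ (proj₂ diameter))))

    count≡p : ∀ {h x y} i j → Dist x y h → h ≤ D → i ≤ D → j ≤ D → count Γ x y i j ≡ p h i j
    count≡p {h} {x} {y} i j x-y h≤D i≤D j≤D = numbers h i j h≤D i≤D j≤D x y (Dist⇒isDist≡true x-y)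

  a₀≡0 : a 0 ≡ 0
  a₀≡0 = trans (sym (count≡p 1 0 (Dist-refl {x₀}) z≤n 1≤D z≤n))
               (count-≡0 {x₀} {x₀} {1} {0} (λ at₁ at₀ → ℕ.1+n≢0 (Dist-unique at₁ at₀)))

  c₁≡1 : c 1 ≡ 1
  c₁≡1 with vertex-at 1≤D
  ... | y , x₀-y = trans (sym (count≡p 1 0 x₀-y 1≤D 1≤D z≤n))
                         (count-≡1 x₀-y Dist-refl (λ _ y-w → sym (Reach-zero⇒≡ (Dist⇒Reach y-w))))

  c+a+b≡k : ∀ j → suc j < D → c (suc j) N.+ a (suc j) N.+ b (suc j) ≡ k
  c+a+b≡k j j+1<D with vertex-at (ℕ.<⇒≤ j+1<D)
  ... | y , x₀-y = begin
    c (suc j) N.+ a (suc j) N.+ b (suc j)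
      ≡⟨ sym (cong₂ N._+_
          (cong₂ N._+_ (count≡p 1 j x₀-y j+1≤D 1≤D (ℕ.<⇒≤ (ℕ.<-trans (ℕ.n<1+n j) j+1<D)))
                                        (count≡p 1 (suc j) x₀-y j+1≤D 1≤D j+1≤D))
                           (count≡p 1 (suc (suc j)) x₀-y j+1≤D 1≤D j+1<D)) ⟩
    count Γ x₀ y 1 j N.+ count Γ x₀ y 1 (suc j) N.+ count Γ x₀ y 1 (suc (suc j))
      ≡⟨ sym (count-split connected x₀-y) ⟩
    count Γ x₀ x₀ 1 1
      ≡⟨ count≡p 1 1 (Dist-refl {x₀}) z≤n 1≤D 1≤D ⟩
    k ∎
    where
    open ≡-Reasoning
    j+1≤D : suc j ≤ D
    j+1≤D = ℕ.<⇒≤ j+1<D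

  c≢0 : ∀ j → suc j < D → c (suc j) ≢ 0
  c≢0 j j+1<D with vertex-at (ℕ.<⇒≤ j+1<D)
  ... | y , x₀-y with Dist-pred (Dist-sym x₀-y)
  ...   | z , y-z , z~x₀ = count-≢0 (Adj⇒Dist₁ (Adj-sym z~x₀)) y-z ∘
      trans (count≡p 1 j x₀-y (ℕ.<⇒≤ j+1<D) 1≤D (ℕ.<⇒≤ (ℕ.<-trans (ℕ.n<1+n j) j+1<D)))

  b≢0 : ∀ j → suc j < D → b (suc j) ≢ 0
  b≢0 j j+1<D with vertex-at j+1<D
  ... | v , x₀-v with Dist-pred x₀-v
  ...   | w , x₀-w , w~v = count-≢0 (Adj⇒Dist₁ w~v) x₀-v ∘
      trans (count≡p 1 (suc (suc j)) (Dist-sym x₀-w) (ℕ.<⇒≤ j+1<D) 1≤D j+1<D)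

  -- On a geodesic x₀ z y v, a₁ ≠ 0 provides a common neighbour t of y and
  -- v; whether ∂(z, t) is 1 or 2, t is counted by a₂ (at x₀, y resp. z, v).
  a₂≢0 : a 2 ≢ 0
  a₂≢0 with vertex-at 3≤D
  ... | v , x₀-v with Dist-pred x₀-v
  ...   | y , x₀-y , y~v with Dist-pred x₀-y
  ...     | z , x₀-z , z~y with count-≢0⁻
      (a₁≢0 ∘ trans (sym (count≡p 1 1 (Adj⇒Dist₁ y~v) 1≤D 1≤D 1≤D)))
  ...       | t , y-t , v-t with connected z t
  ...         | d , z-t′ = by-distance d (isDist≡true⇒Dist z-t′)
                             (Dist-minimal (isDist≡true⇒Dist z-t′)
                                 (Reach-trans (Reach-step Reach-refl z~y) (Dist⇒Reach y-t)))
    where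
    far : ∀ {m} → Reach m x₀ v → 3 ≤ m
    far = Dist-minimal x₀-v
    t~v : Adj t v
    t~v = Adj-sym (Dist₁⇒Adj v-t)
    by-distance : ∀ d → Dist z t d → d ≤ 2 → a 2 ≢ 0
    by-distance zero z-t _ with Reach-zero⇒≡ (Dist⇒Reach z-t)
    ... | refl = ⊥-elim (ℕ.<⇒≱ (s≤s (s≤s (s≤s z≤n))) (far (Reach-step (Dist⇒Reach x₀-z) t~v)))
    by-distance (suc zero) z-t _ = count-≢0 y-t x₀-t
        ∘ trans (count≡p 1 2 (Dist-sym x₀-y) 2≤D 1≤D 2≤D)
      where
      x₀-t : Dist x₀ t 2
      x₀-t = Reach∧minimal⇒Dist (Reach-step (Dist⇒Reach x₀-z) (Dist₁⇒Adj z-t))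
                                (λ r → ℕ.≤-pred (far (Reach-step r t~v)))
    by-distance (suc (suc zero)) z-t _ = count-≢0 v-t z-t
        ∘ trans (count≡p 1 2 (Dist-sym z-v) 2≤D 1≤D 2≤D)
      where
      z-v : Dist z v 2
      z-v = Reach∧minimal⇒Dist (Reach-step (Reach-step Reach-refl z~y) y~v)
                               (λ r → ℕ.≤-pred (far (Reach-trans (Dist⇒Reach x₀-z) r)))
    by-distance (suc (suc (suc d))) _ (s≤s (s≤s ()))

  feasible : FeasibleArray D p
  feasible = record
    { 3≤D = 3≤D ; a₀≡0 = a₀≡0 ; c₁≡1 = c₁≡1 ; c+a+b≡k = c+a+b≡k
    ; c≢0 = c≢0 ; b≢0 = b≢0 ; a₁≢0 = a₁≢0 ; a₂≢0 = a₂≢0 }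

lemma13p2 : (R : RealField) → let open RealField R in
    {n : ℕ} (Γ : Graph n) (D : ℕ) (p : ℕ → ℕ → ℕ → ℕ) →
    Connected Γ → HasDiameter Γ D → IntersectionNumbers Γ D p →
    3 N.≤ D → Params.a D p 1 ≢ 0 →
    (σ : ℕ → Carrier) (ε : Carrier) →
    Cosine.Tight R D p σ → Cosine.AuxiliaryParameter R D p σ ε →
    let s = σ 1
        g = ((ε - 1#) * (1# - σ 2)) * (((s * s - σ 2) * (1# - ε * s)) ⁻¹)
    in (∀ i → 1 N.≤ i → i N.≤ D ∸ 1 →
          (σ (suc i) - σ i) * (σ (i ∸ 1) - σ i) ≢ 0#)
       × ((s * s - σ 2) * (1# - ε * s) ≢ 0#)
       × (∀ i → 1 N.≤ i → i N.≤ D ∸ 1 →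
          fromℕ (Params.a D p i)
            ≡ g * (((σ (suc i) - s * σ i) * (σ (i ∸ 1) - s * σ i))
                   * (((σ (suc i) - σ i) * (σ (i ∸ 1) - σ i)) ⁻¹)))
lemma13p2 R Γ D p connected diameter numbers 3≤D a₁≢0 σ ε
          (σ-nontrivial , _) (_ , ρ-nontrivial , (_ , _ , σρ-pcs) , linked) =
  (λ { (suc j) (s≤s z≤n) j+1≤D-1 → differences≢0 j (m≤n∸1⇒m<n j+1≤D-1) })
  , Δ≢0
  , (λ { (suc j) (s≤s z≤n) j+1≤D-1 → a-formula j (m≤n∸1⇒m<n j+1≤D-1) })
  where
  open Analysis R (IntersectionArray.feasible Γ connected diameter numbers 3≤D a₁≢0)
  open TightPair σ-nontrivial ρ-nontrivial σρ-pcs (λ j j+1≤D → linked (suc j) (s≤s z≤n) j+1≤D)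
  m≤n∸1⇒m<n : ∀ {m n} → suc m N.≤ n ∸ 1 → suc m N.< n
  m≤n∸1⇒m<n {n = suc n} m<n = s≤s m<n
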